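{- Let $G$ be a cubic $K_3$-free graph and $M\subseteq E(G)$, and let $G'$ be the graph obtained from $G$ by attaching a co-fish to every edge of $M$. Then $G$ admits a $\{K_{1,3},P_4\}$-decomposition in which no edge of $M$ is the middle edge of a $P_4$ if and only if $G'$ admits a $\{K_{1,3},K_3,P_4\}$-decomposition.
   Context: All graphs are finite, simple, connected and nontrivial. A graph is cubic if every vertex has degree $3$, and $K_3$-free if it contains no triangle. $K_{1,3}$ is the star with three edges, $K_3$ the triangle, and $P_4$ the path on four vertices (three edges); the middle edge of a $P_4$ is the edge joining its two inner vertices. For a set $S'$ of graphs, an $S'$-decomposition of $H$ is a partition of $E(H)$ into subgraphs each isomorphic to a graph in $S'$. The co-fish is the graph with vertices $a,b,c,d,e,f$ and edges $ab,af,ad,bc,be,cd,ce,de$ (so $f$ is its unique vertex of degree $1$). Attaching a co-fish to an edge $uv$ means: subdivide $uv$ by a new vertex $w$ (replacing $uv$ by $uw$ and $wv$), and add a new copy of the co-fish in which the vertex $f$ is identified with $w$; for distinct edges of $M$ distinct new vertices and distinct copies are used. -}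

module Defs where

open import Data.Nat using (ℕ; _≤_)
open import Data.Fin using (Fin)
open import Data.Bool using (Bool; true; false; T)
open import Data.Empty using (⊥)
open import Data.Unit using (⊤)
open import Data.Product using (Σ; ∃; _×_; _,_; proj₁; proj₂)
open import Data.Sum using (_⊎_; inj₁; inj₂)
open import Data.List using (List; []; _∷_; length; filter; concatMap; lookup; allFin)
open import Data.List.Membership.Propositional using (_∈_)
open import Data.List.Relation.Unary.All using (All)
open import Data.List.Relation.Unary.Any using (Any)
open import Data.List.Relation.Unary.AllPairs using (AllPairs)
open import Relation.Nullary using (¬_)
open import Relation.Binary using (Decidable)
open import Relation.Binary.PropositionalEquality using (_≡_; _≢_; refl)

record Graph (V : Set) : Set₁ where
  field
    Adj   : V → V → Set
    sym   : ∀ {u v} → Adj u v → Adj v u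
    irref : ∀ {v} → ¬ Adj v v
open Graph public

SameEdge : ∀ {V : Set} → V × V → V × V → Set
SameEdge (u , v) (x , y) = (u ≡ x × v ≡ y) ⊎ (u ≡ y × v ≡ x)

SameEdge-swap : ∀ {V : Set} {u v : V} {e : V × V} → SameEdge (v , u) e → SameEdge (u , v) e
SameEdge-swap (inj₁ (p , q)) = inj₂ (q , p)
SameEdge-swap (inj₂ (p , q)) = inj₁ (q , p)

data Reach {V : Set} (G : Graph V) : V → V → Set where
  here : ∀ {v} → Reach G v v
  step : ∀ {u v w} → Adj G u v → Reach G v w → Reach G u w

Connected : ∀ {V : Set} → Graph V → Set
Connected G = ∀ u v → Reach G u v

degree : ∀ {n} (G : Graph (Fin n)) → Decidable (Adj G) → Fin n → ℕ
degree {n} G dec v = length (filter (dec v) (allFin n))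

Cubic : ∀ {n} (G : Graph (Fin n)) → Decidable (Adj G) → Set
Cubic G dec = ∀ v → degree G dec v ≡ 3

K3Free : ∀ {V : Set} → Graph V → Set
K3Free G = ¬ (Σ _ λ x → Σ _ λ y → Σ _ λ z → Adj G x y × Adj G y z × Adj G x z)

data Shape : Set where
  K13 K3 P4 : Shape

data Piece (V : Set) : Set where
  star : V → V → V → V → Piece V   -- centre, three leaves
  tri  : V → V → V → Piece V
  path : V → V → V → V → Piece V   -- a-b-c-d, middle edge bc

shapeOf : ∀ {V} → Piece V → Shape
shapeOf (star _ _ _ _) = K13
shapeOf (tri _ _ _)    = K3
shapeOf (path _ _ _ _) = P4

pieceEdges : ∀ {V} → Piece V → List (V × V)
pieceEdges (star c x y z) = (c , x) ∷ (c , y) ∷ (c , z) ∷ []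
pieceEdges (tri x y z)    = (x , y) ∷ (y , z) ∷ (x , z) ∷ []
pieceEdges (path a b c d) = (a , b) ∷ (b , c) ∷ (c , d) ∷ []

ValidPiece : ∀ {V} → Graph V → Piece V → Set
ValidPiece G (star c x y z) =
  (c ≢ x × c ≢ y × c ≢ z × x ≢ y × x ≢ z × y ≢ z) ×
  (Adj G c x × Adj G c y × Adj G c z)
ValidPiece G (tri x y z) =
  (x ≢ y × x ≢ z × y ≢ z) × (Adj G x y × Adj G y z × Adj G x z)
ValidPiece G (path a b c d) =
  (a ≢ b × a ≢ c × a ≢ d × b ≢ c × b ≢ d × c ≢ d) ×
  (Adj G a b × Adj G b c × Adj G c d)

Decomposition : ∀ {V} → Graph V → List Shape → List (Piece V) → Set
Decomposition G S ps =
  All (λ p → shapeOf p ∈ S × ValidPiece G p) ps ×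
  (∀ u v → Adj G u v → Any (SameEdge (u , v)) (concatMap pieceEdges ps)) ×
  AllPairs (λ e f → ¬ SameEdge e f) (concatMap pieceEdges ps)

MiddleIn : ∀ {V} → List (V × V) → Piece V → Set
MiddleIn M (path a b c d) = Any (SameEdge (b , c)) M
MiddleIn M (star _ _ _ _) = ⊥
MiddleIn M (tri _ _ _)    = ⊥

data CF : Set where
  a b c d e f : CF

cfAdj : CF → CF → Bool
cfAdj a b = true
cfAdj b a = true
cfAdj a f = true
cfAdj f a = true
cfAdj a d = true
cfAdj d a = true
cfAdj b c = true
cfAdj c b = true
cfAdj b e = true
cfAdj e b = true
cfAdj c d = true
cfAdj d c = true
cfAdj c e = true
cfAdj e c = true
cfAdj d e = true
cfAdj e d = true
cfAdj _ _ = false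

cfSym : ∀ p q → T (cfAdj p q) → T (cfAdj q p)
cfSym a b t = t
cfSym b a t = t
cfSym a f t = t
cfSym f a t = t
cfSym a d t = t
cfSym d a t = t
cfSym b c t = t
cfSym c b t = t
cfSym b e t = t
cfSym e b t = t
cfSym c d t = t
cfSym d c t = t
cfSym c e t = t
cfSym e c t = t
cfSym d e t = t
cfSym e d t = t
cfSym a a ()
cfSym a c ()
cfSym a e ()
cfSym b b ()
cfSym b d ()
cfSym b f ()
cfSym c a ()
cfSym c c ()
cfSym c f ()
cfSym d b ()
cfSym d d ()
cfSym d f ()
cfSym e a ()
cfSym e e ()
cfSym e f ()
cfSym f b ()
cfSym f c ()
cfSym f d ()
cfSym f e ()
cfSym f f ()

cfIrr : ∀ p → ¬ T (cfAdj p p)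
cfIrr a ()
cfIrr b ()
cfIrr c ()
cfIrr d ()
cfIrr e ()
cfIrr f ()

-- Vertices of G': old vertices, and for the i-th edge of M a copy of the
-- co-fish, whose vertex f is the subdivision vertex w of that edge.

module _ {n : ℕ} (G : Graph (Fin n)) (M : List (Fin n × Fin n)) where

  V' : Set
  V' = Fin n ⊎ (Fin (length M) × CF)

  Hub : Fin n → Fin (length M) → CF → Set
  Hub u i f = u ≡ proj₁ (lookup M i) ⊎ u ≡ proj₂ (lookup M i)
  Hub u i a = ⊥
  Hub u i b = ⊥
  Hub u i c = ⊥
  Hub u i d = ⊥
  Hub u i e = ⊥

  Adj' : V' → V' → Set
  Adj' (inj₁ u) (inj₁ v) = Adj G u v × ¬ Any (SameEdge (u , v)) M
  Adj' (inj₁ u) (inj₂ (i , p)) = Hub u i p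
  Adj' (inj₂ (i , p)) (inj₁ u) = Hub u i p
  Adj' (inj₂ (i , p)) (inj₂ (j , q)) = i ≡ j × T (cfAdj p q)

  sym' : ∀ {x y} → Adj' x y → Adj' y x
  sym' {inj₁ u} {inj₁ v} (h , nm) = sym G h , λ an → nm (Data.List.Relation.Unary.Any.map SameEdge-swap an)
  sym' {inj₁ u} {inj₂ _} h = h
  sym' {inj₂ _} {inj₁ u} h = h
  sym' {inj₂ (i , p)} {inj₂ (j , q)} (refl , t) = refl , cfSym p q t

  irr' : ∀ {x} → ¬ Adj' x x
  irr' {inj₁ u} (h , _) = irref G h
  irr' {inj₂ (i , p)} (_ , t) = cfIrr p t

  attachCoFish : Graph V'
  attachCoFish = record { Adj = Adj' ; sym = λ {x} {y} → sym' {x} {y} ; irref = λ {x} → irr' {x} }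

-- Forward: in a piece of G, an edge uv ∈ M is never a middle edge, so it is a pendant edge
-- whose inner end u lies in the piece.  Replace uv by the hub edge u w of its co-fish and
-- cover the co-fish together with the other hub edge v w by the path v w a b, the star at d
-- and the triangle b c e.
--
-- Backward: fix the co-fish hung on an edge uv ∈ M and count how the pieces of a decomposition
-- of G′ use its edge f a (exactly once), its eight inner edges and its two hub edges u w, v w.
-- A finite case analysis of how one piece can meet the co-fish shows that a piece avoiding f a
-- uses 0 or 3 inner edges.  Since 8 ≡ 2 (mod 3), the piece through f a is a path b a f x or
-- d a f x with {x , y} = {u , v}, so the hub edge y w lies in a piece in which y is the centre
-- or an inner vertex; reading w there as x turns that piece into a piece of G.  Pieces with a
-- co-fish vertex as centre or inner vertex are dropped, and triangle-freeness of G ensures that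
-- every triangle of G′ lies inside a co-fish.

module Submission where

open import Defs
open import Data.Fin using (Fin; zero; suc)
import Data.Fin.Properties as Fin
open import Data.Bool using (Bool; true; false; T)
open import Data.Unit using (⊤; tt)
open import Data.Nat using (ℕ; zero; suc; _+_; _*_; _%_; _≤_; _≤?_; z≤n; s≤s)
open import Data.Nat.Divisibility using (_∣_; _∣?_; divides-refl; _∣0; ∣m∣n⇒∣m+n)
open import Data.Nat.DivMod using ([m+kn]%n≡m%n)
open import Data.Nat.Properties as ℕ
  using (+-assoc; +-comm; +-suc; +-identityʳ; m+n≡0⇒m≡0; m+n≡0⇒n≡0; m+n≤o⇒m≤o; m+n≤o⇒n≤o; +-mono-≤; ≤-refl; ≤-trans; ≤-reflexive)
open import Data.Nat.ListAction using (sum)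
open import Data.Nat.ListAction.Properties using (sum-++)
open import Data.Product as Prod using (Σ; _×_; _,_; proj₁; proj₂)
open import Data.Sum using (_⊎_; inj₁; inj₂)
open import Data.Sum.Properties as Sum using (inj₁-injective; inj₂-injective)
import Data.Product.Properties as Prod
open import Data.List using (List; []; _∷_; _++_; map; concatMap; length; lookup)
open import Data.List.Properties using (map-++; map-∘; map-cong; concatMap-++)
open import Data.List.Relation.Unary.All as All using (All; []; _∷_)
import Data.List.Relation.Unary.All.Properties as All
open import Data.List.Relation.Unary.Any as Any using (Any; here; there)
open import Data.List.Relation.Unary.Any.Properties using (lookup-index)
open import Data.List.Membership.Propositional using (_∈_; lose)
open import Data.List.Membership.Propositional.Properties using (∈-lookup)
open import Data.List.Relation.Unary.AllPairs using (AllPairs; []; _∷_)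
open import Data.Empty using (⊥; ⊥-elim)
open import Relation.Nullary using (¬_; ¬?; Dec; yes; no)
open import Relation.Nullary.Decidable using (map′; T?; _×-dec_; _⊎-dec_; _→-dec_; from-yes)
open import Relation.Binary using (Decidable; DecidableEquality)
open import Function.Bundles using (_⇔_; mk⇔)
open import Relation.Binary.PropositionalEquality using (_≡_; _≢_; refl; trans; cong; cong₂; subst)
import Relation.Binary.PropositionalEquality as ≡
open ≡.≡-Reasoning
open import Data.Nat.Tactic.RingSolver using (solve-∀)
open import Algebra.Properties.CommutativeSemigroup ℕ.+-commutativeSemigroup using (interchange)

private variable
  A B : Set
  P Q : Set

indicator : Dec P → ℕ
indicator (yes _) = 1
indicator (no _) = 0

indicator-yes : (P? : Dec P) → P → indicator P? ≡ 1
indicator-yes (yes _) _ = refl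
indicator-yes (no ¬p) p = ⊥-elim (¬p p)

indicator-no : (P? : Dec P) → ¬ P → indicator P? ≡ 0
indicator-no (yes p) ¬p = ⊥-elim (¬p p)
indicator-no (no _) _ = refl

indicator-cong : (P? : Dec P) (Q? : Dec Q) → (P → Q) → (Q → P) → indicator P? ≡ indicator Q?
indicator-cong (yes _) (yes _) _ _ = refl
indicator-cong (yes p) (no ¬q) p⇒q _ = ⊥-elim (¬q (p⇒q p))
indicator-cong (no ¬p) (yes q) _ q⇒p = ⊥-elim (¬p (q⇒p q))
indicator-cong (no _) (no _) _ _ = refl

indicator-mono : (P? : Dec P) (Q? : Dec Q) → (P → Q) → indicator P? ≤ indicator Q?
indicator-mono (yes p) (yes _) _ = ≤-refl
indicator-mono (yes p) (no ¬q) p⇒q = ⊥-elim (¬q (p⇒q p))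
indicator-mono (no _) _ _ = z≤n

+-interleave₃ : ∀ i₁ i₂ i₃ k₁ k₂ k₃ → (i₁ + (i₂ + (i₃ + 0))) + (k₁ + (k₂ + (k₃ + 0))) ≡ (i₁ + k₁) + ((i₂ + k₂) + ((i₃ + k₃) + 0))
+-interleave₃ = solve-∀

∑ : (A → ℕ) → List A → ℕ
∑ g xs = sum (map g xs)

∑-++ : (g : A → ℕ) (xs ys : List A) → ∑ g (xs ++ ys) ≡ ∑ g xs + ∑ g ys
∑-++ g xs ys = trans (cong sum (map-++ g xs ys)) (sum-++ (map g xs) (map g ys))

module _ {g h : A → ℕ} where

  ∑-cong-All : {xs : List A} → All (λ x → g x ≡ h x) xs → ∑ g xs ≡ ∑ h xs
  ∑-cong-All [] = refl
  ∑-cong-All (eq ∷ eqs) = cong₂ _+_ eq (∑-cong-All eqs)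

  ∑-cong : (∀ x → g x ≡ h x) → ∀ xs → ∑ g xs ≡ ∑ h xs
  ∑-cong eq xs = cong sum (map-cong eq xs)

  ∑-mono : (∀ x → g x ≤ h x) → ∀ xs → ∑ g xs ≤ ∑ h xs
  ∑-mono le [] = z≤n
  ∑-mono le (x ∷ xs) = +-mono-≤ (le x) (∑-mono le xs)

  ∑-+ : ∀ xs → ∑ (λ x → g x + h x) xs ≡ ∑ g xs + ∑ h xs
  ∑-+ [] = refl
  ∑-+ (x ∷ xs) = trans (cong (g x + h x +_) (∑-+ xs)) (interchange (g x) (h x) _ _)

∑-concatMap : (g : B → ℕ) (h : A → List B) (xs : List A) → ∑ g (concatMap h xs) ≡ ∑ (λ x → ∑ g (h x)) xs
∑-concatMap g h [] = refl
∑-concatMap g h (x ∷ xs) = trans (∑-++ g (h x) (concatMap h xs)) (cong (∑ g (h x) +_) (∑-concatMap g h xs))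

∑-zero : (xs : List A) → ∑ (λ _ → 0) xs ≡ 0
∑-zero [] = refl
∑-zero (_ ∷ xs) = ∑-zero xs

∑-comm : (k : A → B → ℕ) (xs : List A) (ys : List B) →
         ∑ (λ x → ∑ (k x) ys) xs ≡ ∑ (λ y → ∑ (λ x → k x y) xs) ys
∑-comm k [] ys = ≡.sym (∑-zero ys)
∑-comm k (x ∷ xs) ys = trans (cong (∑ (k x) ys +_) (∑-comm k xs ys)) (≡.sym (∑-+ {g = k x} {h = λ y → ∑ (λ x′ → k x′ y) xs} ys))

∑≡0⇒ : {g : A → ℕ} (xs : List A) → ∑ g xs ≡ 0 → All (λ x → g x ≡ 0) xs
∑≡0⇒ [] _ = []
∑≡0⇒ {g = g} (x ∷ xs) eq = m+n≡0⇒m≡0 (g x) eq ∷ ∑≡0⇒ xs (m+n≡0⇒n≡0 (g x) eq)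

∑≤⇒ : {g : A → ℕ} {k : ℕ} (xs : List A) → ∑ g xs ≤ k → All (λ x → g x ≤ k) xs
∑≤⇒ [] _ = []
∑≤⇒ {g = g} (x ∷ xs) le = m+n≤o⇒m≤o (g x) le ∷ ∑≤⇒ xs (m+n≤o⇒n≤o (g x) le)

∑-map : (g : B → ℕ) (h : A → B) (xs : List A) → ∑ g (map h xs) ≡ ∑ (λ x → g (h x)) xs
∑-map g h xs = cong sum (≡.sym (map-∘ xs))

∑-∣ : {g : A → ℕ} {k : ℕ} (xs : List A) → All (λ x → k ∣ g x) xs → k ∣ ∑ g xs
∑-∣ {k = k} [] [] = k ∣0
∑-∣ (x ∷ xs) (k∣x ∷ k∣xs) = ∣m∣n⇒∣m+n k∣x (∑-∣ xs k∣xs)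

mapEdge : (A → B) → A × A → B × B
mapEdge h = Prod.map h h

module _ {V : Set} where

  SameEdge-refl : (x : V × V) → SameEdge x x
  SameEdge-refl _ = inj₁ (refl , refl)

  SameEdge-sym : {x y : V × V} → SameEdge x y → SameEdge y x
  SameEdge-sym (inj₁ (refl , refl)) = inj₁ (refl , refl)
  SameEdge-sym (inj₂ (refl , refl)) = inj₂ (refl , refl)

  SameEdge-trans : {x y z : V × V} → SameEdge x y → SameEdge y z → SameEdge x z
  SameEdge-trans (inj₁ (refl , refl)) yz = yz
  SameEdge-trans (inj₂ (refl , refl)) (inj₁ (refl , refl)) = inj₂ (refl , refl)
  SameEdge-trans (inj₂ (refl , refl)) (inj₂ (refl , refl)) = inj₁ (refl , refl)

  SameEdge-flipʳ : {x : V × V} {u v : V} → SameEdge x (u , v) → SameEdge x (v , u)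
  SameEdge-flipʳ (inj₁ (refl , refl)) = inj₂ (refl , refl)
  SameEdge-flipʳ (inj₂ (refl , refl)) = inj₁ (refl , refl)

  distinct-lookup-injective : ∀ {xs : List (V × V)} → AllPairs (λ x y → ¬ SameEdge x y) xs →
                              ∀ i j → SameEdge (lookup xs i) (lookup xs j) → i ≡ j
  distinct-lookup-injective {_ ∷ _} _ zero zero _ = refl
  distinct-lookup-injective {_ ∷ _} (x≉xs ∷ _) zero (suc j) x≈ = ⊥-elim (All.lookup x≉xs (∈-lookup j) x≈)
  distinct-lookup-injective {_ ∷ _} (x≉xs ∷ _) (suc i) zero ≈x = ⊥-elim (All.lookup x≉xs (∈-lookup i) (SameEdge-sym ≈x))
  distinct-lookup-injective {_ ∷ _} (_ ∷ distinct) (suc i) (suc j) ≈ = cong suc (distinct-lookup-injective distinct i j ≈)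

  IsEdge : Graph V → V × V → Set
  IsEdge H (u , v) = Adj H u v

  IsEdge-resp : (H : Graph V) {x y : V × V} → SameEdge x y → IsEdge H x → IsEdge H y
  IsEdge-resp H (inj₁ (refl , refl)) uv = uv
  IsEdge-resp H (inj₂ (refl , refl)) uv = sym H uv

  ValidIn : Graph V → List Shape → Piece V → Set
  ValidIn H S p = shapeOf p ∈ S × ValidPiece H p

  edges : List (Piece V) → List (V × V)
  edges = concatMap pieceEdges

  valid⇒edges : (H : Graph V) (p : Piece V) → ValidPiece H p → All (IsEdge H) (pieceEdges p)
  valid⇒edges H (star _ _ _ _) (_ , e₁ , e₂ , e₃) = e₁ ∷ e₂ ∷ e₃ ∷ []
  valid⇒edges H (tri _ _ _) (_ , e₁ , e₂ , e₃) = e₁ ∷ e₂ ∷ e₃ ∷ []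
  valid⇒edges H (path _ _ _ _) (_ , e₁ , e₂ , e₃) = e₁ ∷ e₂ ∷ e₃ ∷ []

SameEdge-map : (h : A → B) {x y : A × A} → SameEdge x y → SameEdge (mapEdge h x) (mapEdge h y)
SameEdge-map h (inj₁ (refl , refl)) = inj₁ (refl , refl)
SameEdge-map h (inj₂ (refl , refl)) = inj₂ (refl , refl)

SameEdge-map⁻ : {h : A → B} → (∀ {x y} → h x ≡ h y → x ≡ y) →
                {x y : A × A} → SameEdge (mapEdge h x) (mapEdge h y) → SameEdge x y
SameEdge-map⁻ inj (inj₁ (eq₁ , eq₂)) = inj₁ (inj eq₁ , inj eq₂)
SameEdge-map⁻ inj (inj₂ (eq₁ , eq₂)) = inj₂ (inj eq₁ , inj eq₂)

module EdgeCount {V : Set} (_≟_ : DecidableEquality V) where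

  _≈?_ : (x y : V × V) → Dec (SameEdge x y)
  (u , v) ≈? (x , y) = ((u ≟ x) ×-dec (v ≟ y)) ⊎-dec ((u ≟ y) ×-dec (v ≟ x))

  count : V × V → List (V × V) → ℕ
  count x = ∑ (λ y → indicator (x ≈? y))

  count-resp : ∀ {x x′} (ys : List (V × V)) → SameEdge x x′ → count x ys ≡ count x′ ys
  count-resp {x} {x′} ys x≈x′ = ∑-cong (λ y → indicator-cong (x ≈? y) (x′ ≈? y)
    (SameEdge-trans (SameEdge-sym x≈x′)) (SameEdge-trans x≈x′)) ys

  indicator-sym : ∀ x y → indicator (x ≈? y) ≡ indicator (y ≈? x)
  indicator-sym x y = indicator-cong (x ≈? y) (y ≈? x) SameEdge-sym SameEdge-sym

  count-++ : ∀ x ys zs → count x (ys ++ zs) ≡ count x ys + count x zs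
  count-++ x = ∑-++ (λ y → indicator (x ≈? y))

  indicator-flip : ∀ x u v → indicator (x ≈? (u , v)) ≡ indicator (x ≈? (v , u))
  indicator-flip x u v = indicator-cong (x ≈? _) (x ≈? _) SameEdge-flipʳ SameEdge-flipʳ

  count≡0 : ∀ {x} {ys : List (V × V)} → All (λ y → ¬ SameEdge x y) ys → count x ys ≡ 0
  count≡0 {x} {ys} ¬xs = trans (∑-cong-All (All.map (indicator-no (x ≈? _)) ¬xs)) (∑-zero ys)

  count≡0⇒ : ∀ {x} (ys : List (V × V)) → count x ys ≡ 0 → All (λ y → ¬ SameEdge x y) ys
  count≡0⇒ {x} ys eq = All.map (λ {y} none x≈y → 1≢0 (trans (≡.sym (indicator-yes (x ≈? y) x≈y)) none)) (∑≡0⇒ ys eq)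
    where
    1≢0 : 1 ≡ 0 → ⊥
    1≢0 ()

  count-unique : ∀ {x} {ys : List (V × V)} → AllPairs (λ y z → ¬ SameEdge y z) ys → Any (SameEdge x) ys →
                 count x ys ≡ 1
  count-unique {x} (¬y≈ys ∷ _) (here x≈y) =
    cong₂ _+_ (indicator-yes (x ≈? _) x≈y) (count≡0 (All.map (λ ¬y≈z x≈z → ¬y≈z (SameEdge-trans (SameEdge-sym x≈y) x≈z)) ¬y≈ys))
  count-unique {x} {y ∷ _} (¬y≈ys ∷ unique) (there x∈ys) =
    cong₂ _+_ (indicator-no (x ≈? y) λ x≈y → All.lookupWith (λ ¬y≈z x≈z → ¬y≈z (SameEdge-trans (SameEdge-sym x≈y) x≈z)) ¬y≈ys x∈ys)
              (count-unique unique x∈ys)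

  count≡1⇒Any : ∀ {x} (ys : List (V × V)) → count x ys ≡ 1 → Any (SameEdge x) ys
  count≡1⇒Any {x} (y ∷ ys) eq with x ≈? y
  ... | yes x≈y = here x≈y
  ... | no _ = there (count≡1⇒Any ys eq)

  count≤1⇒unique : {E : V × V → Set} (ys : List (V × V)) → All E ys → (∀ x → E x → count x ys ≤ 1) →
                   AllPairs (λ y z → ¬ SameEdge y z) ys
  count≤1⇒unique [] _ _ = []
  count≤1⇒unique (y ∷ ys) (Ey ∷ Eys) bound =
    count≡0⇒ ys (head-alone (bound y Ey)) ∷ count≤1⇒unique ys Eys λ x Ex → m+n≤o⇒n≤o (indicator (x ≈? y)) (bound x Ex)
    where
    head-alone : count y (y ∷ ys) ≤ 1 → count y ys ≡ 0
    head-alone le with count y ys | ≤-trans (≤-reflexive (cong (_+ count y ys) (≡.sym (indicator-yes (y ≈? y) (SameEdge-refl y))))) le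
    ... | zero | _ = refl
    ... | suc _ | s≤s ()

  count-edges : ∀ x (ps : List (Piece V)) → count x (edges ps) ≡ ∑ (λ p → count x (pieceEdges p)) ps
  count-edges x = ∑-concatMap (λ y → indicator (x ≈? y)) pieceEdges

  count-edges-concatMap : ∀ x {A : Set} (k : A → List (Piece V)) (qs : List A) →
                          count x (edges (concatMap k qs)) ≡ ∑ (λ q → count x (edges (k q))) qs
  count-edges-concatMap x k qs = begin
    count x (edges (concatMap k qs))                         ≡⟨ count-edges x (concatMap k qs) ⟩
    ∑ (λ p → count x (pieceEdges p)) (concatMap k qs)        ≡⟨ ∑-concatMap _ k qs ⟩
    ∑ (λ q → ∑ (λ p → count x (pieceEdges p)) (k q)) qs      ≡⟨ ∑-cong (λ q → count-edges x (k q)) qs ⟨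
    ∑ (λ q → count x (edges (k q))) qs                       ∎

  count-edges-++ : ∀ x (ps qs : List (Piece V)) → count x (edges (ps ++ qs)) ≡ count x (edges ps) + count x (edges qs)
  count-edges-++ x ps qs = trans (cong (count x) (concatMap-++ pieceEdges ps qs)) (count-++ x (edges ps) (edges qs))

  module _ (H : Graph V) (S : List Shape) where

    decomposition⇒count≡1 : ∀ {ps} → Decomposition H S ps → ∀ {x} → IsEdge H x → count x (edges ps) ≡ 1
    decomposition⇒count≡1 (_ , covers , unique) {u , v} uv = count-unique unique (covers u v uv)

    count≡1⇒decomposition : ∀ {ps} → All (ValidIn H S) ps →
                            (∀ {x} → IsEdge H x → count x (edges ps) ≡ 1) → Decomposition H S ps
    count≡1⇒decomposition {ps} valid once =
      valid ,
      (λ u v uv → count≡1⇒Any (edges ps) (once uv)) ,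
      count≤1⇒unique (edges ps) (All.concat⁺ (All.map⁺ (All.map (λ {p} v → valid⇒edges H p (proj₂ v)) valid)))
        (λ x Ex → ≤-reflexive (once Ex))

module CountMap {A B : Set} (_≟A_ : DecidableEquality A) (_≟B_ : DecidableEquality B) (h : A → B) where
  open EdgeCount _≟A_ using (_≈?_; count)
  open EdgeCount _≟B_ using () renaming (_≈?_ to _≈′?_; count to count′)

  count-map-≤ : ∀ x ys → count x ys ≤ count′ (mapEdge h x) (map (mapEdge h) ys)
  count-map-≤ x ys = ≤-trans
    (∑-mono (λ y → indicator-mono (x ≈? y) (mapEdge h x ≈′? mapEdge h y) (SameEdge-map h)) ys)
    (≤-reflexive (≡.sym (∑-map (λ y → indicator (mapEdge h x ≈′? y)) (mapEdge h) ys)))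

  count-map-reflect : ∀ {s t} → (∀ {x} → h x ≡ h s → x ≡ s) → (∀ {x} → h x ≡ h t → x ≡ t) →
                      ∀ ys → count′ (h s , h t) (map (mapEdge h) ys) ≡ count (s , t) ys
  count-map-reflect {s} {t} at-s at-t ys = trans (∑-map (λ y → indicator ((h s , h t) ≈′? y)) (mapEdge h) ys)
    (∑-cong (λ y → indicator-cong ((h s , h t) ≈′? mapEdge h y) ((s , t) ≈? y) reflect (SameEdge-map h)) ys)
    where
    reflect : ∀ {y} → SameEdge (h s , h t) (mapEdge h y) → SameEdge (s , t) y
    reflect (inj₁ (hs≡ , ht≡)) = inj₁ (≡.sym (at-s (≡.sym hs≡)) , ≡.sym (at-t (≡.sym ht≡)))
    reflect (inj₂ (hs≡ , ht≡)) = inj₂ (≡.sym (at-s (≡.sym hs≡)) , ≡.sym (at-t (≡.sym ht≡)))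

remainder-two : ∀ {s t} → 3 ∣ s → t ≤ 3 → s + t ≡ 8 → t ≡ 2
remainder-two {t = t} (divides-refl q) t≤3 eq = small t≤3 (begin
  t % 3            ≡⟨ [m+kn]%n≡m%n t q 3 ⟨
  (t + q * 3) % 3  ≡⟨ cong (_% 3) (trans (+-comm t (q * 3)) eq) ⟩
  2                ∎)
  where
  small : ∀ {t} → t ≤ 3 → t % 3 ≡ 2 → t ≡ 2
  small {0} _ ()
  small {1} _ ()
  small {2} _ _ = refl
  small {3} _ ()
  small {suc (suc (suc (suc _)))} (s≤s (s≤s (s≤s ()))) _

module Budget {X : Set} (fa inner hub : X → ℕ) where

  Classified : X → Set
  Classified x = inner x ≤ 3 × (fa x ≡ 0 → 3 ∣ inner x) × (fa x ≡ 1 → inner x ≡ 2 → hub x ≡ 1)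

  Admissible : X → Set
  Admissible x = (fa x ≡ 0 × hub x ≤ 1) ⊎ (fa x ≡ 1 × inner x ≡ 2)

  classified? : ∀ x → Dec (Classified x)
  classified? x = (inner x ≤? 3) ×-dec ((fa x ℕ.≟ 0) →-dec (3 ∣? inner x)) ×-dec
                  ((fa x ℕ.≟ 1) →-dec (inner x ℕ.≟ 2) →-dec (hub x ℕ.≟ 1))

  admissible? : ∀ x → Dec (Admissible x)
  admissible? x = ((fa x ℕ.≟ 0) ×-dec (hub x ≤? 1)) ⊎-dec ((fa x ℕ.≟ 1) ×-dec (inner x ℕ.≟ 2))

  split-at-one : ∀ xs → ∑ fa xs ≡ 1 →
                 Σ (List X) λ ys → Σ X λ x → Σ (List X) λ zs →
                 xs ≡ ys ++ x ∷ zs × ∑ fa ys ≡ 0 × fa x ≡ 1 × ∑ fa zs ≡ 0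
  split-at-one (x ∷ xs) eq with fa x in fa-x
  ... | 1 = [] , x , xs , refl , refl , fa-x , ℕ.suc-injective eq
  ... | 0 with split-at-one xs eq
  ...   | ys , y , zs , refl , fa-ys , fa-y , fa-zs = x ∷ ys , y , zs , refl , trans (cong (_+ ∑ fa ys) fa-x) fa-ys , fa-y , fa-zs

  private
    fa-free : ∀ ws → All Classified ws → ∑ fa ws ≡ 0 → All (λ w → fa w ≡ 0) ws × 3 ∣ ∑ inner ws
    fa-free ws classified fa≡0 = fa-ws , ∑-∣ ws (All.zipWith (λ (cls , fa-w) → proj₁ (proj₂ cls) fa-w) (classified , fa-ws))
      where
      fa-ws : All (λ w → fa w ≡ 0) ws
      fa-ws = ∑≡0⇒ ws fa≡0

  -- Since 8 ≡ 2 (mod 3), the piece through f a carries two inner edges and one hub edge,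
  -- which leaves at most one hub edge for every other piece.
  all-admissible : ∀ xs → All Classified xs → ∑ fa xs ≡ 1 → ∑ inner xs ≡ 8 → ∑ hub xs ≡ 2 → All Admissible xs
  all-admissible xs classified fa≡1 inner≡8 hub≡2 with split-at-one xs fa≡1
  ... | ys , x , zs , refl , fa-ys , fa-x , fa-zs =
    All.++⁺ (All.zipWith inj₁ (proj₁ free-ys , hub≤1-ys)) (inj₂ (fa-x , inner-x) ∷ All.zipWith inj₁ (proj₁ free-zs , hub≤1-zs))
    where
    cls-x : Classified x
    cls-x = All.head (All.++⁻ʳ ys classified)

    free-ys : All (λ w → fa w ≡ 0) ys × 3 ∣ ∑ inner ys
    free-ys = fa-free ys (All.++⁻ˡ ys classified) fa-ys

    free-zs : All (λ w → fa w ≡ 0) zs × 3 ∣ ∑ inner zs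
    free-zs = fa-free zs (All.tail (All.++⁻ʳ ys classified)) fa-zs

    inner-x : inner x ≡ 2
    inner-x = remainder-two (∣m∣n⇒∣m+n (proj₂ free-ys) (proj₂ free-zs)) (proj₁ cls-x) (begin
      ∑ inner ys + ∑ inner zs + inner x    ≡⟨ +-assoc (∑ inner ys) _ _ ⟩
      ∑ inner ys + (∑ inner zs + inner x)  ≡⟨ cong (∑ inner ys +_) (+-comm (∑ inner zs) _) ⟩
      ∑ inner ys + (inner x + ∑ inner zs)  ≡⟨ ∑-++ inner ys (x ∷ zs) ⟨
      ∑ inner (ys ++ x ∷ zs)               ≡⟨ inner≡8 ⟩
      8                                    ∎)

    hub-rest : ∑ hub ys + ∑ hub zs ≡ 1
    hub-rest = ℕ.suc-injective (begin
      suc (∑ hub ys + ∑ hub zs)            ≡⟨ +-suc (∑ hub ys) _ ⟨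
      ∑ hub ys + (1 + ∑ hub zs)            ≡⟨ cong (λ h → ∑ hub ys + (h + ∑ hub zs)) (proj₂ (proj₂ cls-x) fa-x inner-x) ⟨
      ∑ hub ys + (hub x + ∑ hub zs)        ≡⟨ ∑-++ hub ys (x ∷ zs) ⟨
      ∑ hub (ys ++ x ∷ zs)                 ≡⟨ hub≡2 ⟩
      2                                    ∎)

    hub≤1-ys : All (λ w → hub w ≤ 1) ys
    hub≤1-ys = ∑≤⇒ ys (m+n≤o⇒m≤o (∑ hub ys) (≤-reflexive hub-rest))

    hub≤1-zs : All (λ w → hub w ≤ 1) zs
    hub≤1-zs = ∑≤⇒ zs (m+n≤o⇒n≤o (∑ hub ys) (≤-reflexive hub-rest))

mapPiece : (A → B) → Piece A → Piece B
mapPiece h (star w x y z) = star (h w) (h x) (h y) (h z)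
mapPiece h (tri x y z) = tri (h x) (h y) (h z)
mapPiece h (path w x y z) = path (h w) (h x) (h y) (h z)

vertices : Piece A → List A
vertices (star w x y z) = w ∷ x ∷ y ∷ z ∷ []
vertices (tri x y z) = x ∷ y ∷ z ∷ []
vertices (path w x y z) = w ∷ x ∷ y ∷ z ∷ []

pieceEdges-mapPiece : (h : A → B) (p : Piece A) → pieceEdges (mapPiece h p) ≡ map (mapEdge h) (pieceEdges p)
pieceEdges-mapPiece h (star _ _ _ _) = refl
pieceEdges-mapPiece h (tri _ _ _) = refl
pieceEdges-mapPiece h (path _ _ _ _) = refl

vertices-mapPiece : (h : A → B) (p : Piece A) → vertices (mapPiece h p) ≡ map h (vertices p)
vertices-mapPiece h (star _ _ _ _) = refl
vertices-mapPiece h (tri _ _ _) = refl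
vertices-mapPiece h (path _ _ _ _) = refl

-- The role of a vertex of G′ relative to the i-th co-fish: a vertex of G, a vertex of another
-- co-fish, or the vertex p of the i-th co-fish.  roleAdj over-approximates adjacency in G′, so
-- every fact decided below by evaluation over all 8⁴ role-pieces holds for the pieces of G′.

data Role : Set where
  old alien : Role
  own : CF → Role

roleOf : Fin 8 → Role
roleOf zero = old
roleOf (suc zero) = alien
roleOf (suc (suc zero)) = own a
roleOf (suc (suc (suc zero))) = own b
roleOf (suc (suc (suc (suc zero)))) = own c
roleOf (suc (suc (suc (suc (suc zero))))) = own d
roleOf (suc (suc (suc (suc (suc (suc zero)))))) = own e
roleOf (suc (suc (suc (suc (suc (suc (suc zero))))))) = own f

roleIndex : Role → Fin 8
roleIndex old = zero
roleIndex alien = suc zero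
roleIndex (own a) = suc (suc zero)
roleIndex (own b) = suc (suc (suc zero))
roleIndex (own c) = suc (suc (suc (suc zero)))
roleIndex (own d) = suc (suc (suc (suc (suc zero))))
roleIndex (own e) = suc (suc (suc (suc (suc (suc zero)))))
roleIndex (own f) = suc (suc (suc (suc (suc (suc (suc zero))))))

roleOf-roleIndex : ∀ x → roleOf (roleIndex x) ≡ x
roleOf-roleIndex old = refl
roleOf-roleIndex alien = refl
roleOf-roleIndex (own a) = refl
roleOf-roleIndex (own b) = refl
roleOf-roleIndex (own c) = refl
roleOf-roleIndex (own d) = refl
roleOf-roleIndex (own e) = refl
roleOf-roleIndex (own f) = refl

_≟R_ : DecidableEquality Role
x ≟R y = map′ (λ eq → trans (≡.sym (roleOf-roleIndex x)) (trans (cong roleOf eq) (roleOf-roleIndex y)))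
              (cong roleIndex) (roleIndex x Fin.≟ roleIndex y)

own-injective : ∀ {p q} → own p ≡ own q → p ≡ q
own-injective refl = refl

_≟CF_ : DecidableEquality CF
p ≟CF q = map′ own-injective (cong own) (own p ≟R own q)

∀-Role? : {P : Role → Set} → (∀ x → Dec (P x)) → Dec (∀ x → P x)
∀-Role? {P} P? = map′ (λ ∀i x → subst P (roleOf-roleIndex x) (∀i (roleIndex x))) (λ ∀x i → ∀x (roleOf i))
                      (Fin.all? (λ i → P? (roleOf i)))

∀-CF? : {P : CF → Set} → (∀ p → Dec (P p)) → Dec (∀ p → P p)
∀-CF? {P} P? = map′ (λ ∀x p → ∀x (own p)) (λ ∀p → λ { old → tt ; alien → tt ; (own p) → ∀p p }) (∀-Role? onOwn?)
  where
  OnOwn : Role → Set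
  OnOwn (own p) = P p
  OnOwn _ = ⊤
  onOwn? : ∀ x → Dec (OnOwn x)
  onOwn? (own p) = P? p
  onOwn? old = yes tt
  onOwn? alien = yes tt

∀-Piece? : {P : Piece Role → Set} → (∀ p → Dec (P p)) → Dec (∀ p → P p)
∀-Piece? {P} P? =
  map′ glue (λ ∀p → (λ w x y z → ∀p (star w x y z)) , (λ x y z → ∀p (tri x y z)) , (λ w x y z → ∀p (path w x y z)))
  ((∀-Role? λ w → ∀-Role? λ x → ∀-Role? λ y → ∀-Role? λ z → P? (star w x y z)) ×-dec
   (∀-Role? λ x → ∀-Role? λ y → ∀-Role? λ z → P? (tri x y z)) ×-dec
   (∀-Role? λ w → ∀-Role? λ x → ∀-Role? λ y → ∀-Role? λ z → P? (path w x y z)))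
  where
  glue : _ → ∀ p → P p
  glue (∀s , _ , _) (star w x y z) = ∀s w x y z
  glue (_ , ∀t , _) (tri x y z) = ∀t x y z
  glue (_ , _ , ∀p) (path w x y z) = ∀p w x y z

roleAdj : Role → Role → Bool
roleAdj (own p) (own q) = cfAdj p q
roleAdj (own f) old = true
roleAdj old (own f) = true
roleAdj (own _) _ = false
roleAdj _ (own _) = false
roleAdj _ _ = true

RoleEdge : Role × Role → Set
RoleEdge (x , y) = T (roleAdj x y)

ValidRoles : Piece Role → Set
ValidRoles p = All RoleEdge (pieceEdges p)

validRoles? : ∀ p → Dec (ValidRoles p)
validRoles? p = All.all? (λ (x , y) → T? (roleAdj x y)) (pieceEdges p)

cfEdges : List (CF × CF)
cfEdges = (f , a) ∷ (a , b) ∷ (d , a) ∷ (d , c) ∷ (d , e) ∷ (b , c) ∷ (c , e) ∷ (b , e) ∷ []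

cfEdges-once : ∀ p q → T (cfAdj p q) → EdgeCount.count _≟CF_ (p , q) cfEdges ≡ 1
cfEdges-once = from-yes (∀-CF? λ p → ∀-CF? λ q → T? (cfAdj p q) →-dec (EdgeCount.count _≟CF_ (p , q) cfEdges ℕ.≟ 1))

module RoleCount = EdgeCount _≟R_
open RoleCount using () renaming (count to countR; _≈?_ to _≈R?_; indicator-flip to indicator-flipR)

faCount hubCount oldCount innerCount : Piece Role → ℕ
faCount p = countR (own f , own a) (pieceEdges p)
hubCount p = countR (old , own f) (pieceEdges p)
oldCount p = countR (old , old) (pieceEdges p)
innerCount p = ∑ (λ pq → countR (mapEdge own pq) (pieceEdges p)) cfEdges

open Budget faCount innerCount hubCount

IsOwn : Role → Set
IsOwn (own _) = ⊤
IsOwn _ = ⊥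

isOwn? : ∀ x → Dec (IsOwn x)
isOwn? (own _) = yes tt
isOwn? old = no λ ()
isOwn? alien = no λ ()

InCopy : Piece Role → Set
InCopy (star w _ _ _) = IsOwn w
InCopy (tri x y z) = IsOwn x × IsOwn y × IsOwn z
InCopy (path _ x y _) = IsOwn x ⊎ IsOwn y

inCopy? : ∀ p → Dec (InCopy p)
inCopy? (star w _ _ _) = isOwn? w
inCopy? (tri x y z) = isOwn? x ×-dec isOwn? y ×-dec isOwn? z
inCopy? (path _ x y _) = isOwn? x ⊎-dec isOwn? y

Confined : Piece Role → Set
Confined p = All (_≢ alien) (vertices p) × oldCount p ≡ 0 × faCount p ≡ hubCount p

classify : ∀ p → ValidRoles p → Classified p
classify = from-yes (∀-Piece? λ p → validRoles? p →-dec classified? p)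

in-copy⇒confined : ∀ p → ValidRoles p → InCopy p → Admissible p → Confined p
in-copy⇒confined = from-yes (∀-Piece? λ p → validRoles? p →-dec inCopy? p →-dec admissible? p →-dec
  All.all? (λ x → ¬? (x ≟R alien)) (vertices p) ×-dec (oldCount p ℕ.≟ 0) ×-dec (faCount p ℕ.≟ hubCount p))

no-own⇒no-hub : ∀ p → All (λ x → ¬ IsOwn x) (vertices p) → faCount p ≡ 0 × hubCount p ≡ 0
no-own⇒no-hub = from-yes (∀-Piece? λ p → All.all? (λ x → ¬? (isOwn? x)) (vertices p) →-dec
  (faCount p ℕ.≟ 0) ×-dec (hubCount p ℕ.≟ 0))

pattern base u = inj₁ u
pattern fish i p = inj₂ (i , p)

module Gadget {n : ℕ} (G : Graph (Fin n)) (M : List (Fin n × Fin n))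
              (M⊆E : All (IsEdge G) M) (M-distinct : AllPairs (λ x y → ¬ SameEdge x y) M) where

  W : Set
  W = V' G M

  G′ : Graph W
  G′ = attachCoFish G M

  edgeM : Fin (length M) → Fin n × Fin n
  edgeM = lookup M

  InM : Fin n × Fin n → Set
  InM x = Any (SameEdge x) M

  _≟W_ : DecidableEquality W
  _≟W_ = Sum.≡-dec Fin._≟_ (Prod.≡-dec Fin._≟_ _≟CF_)

  open EdgeCount (Fin._≟_ {n}) using (_≈?_; count; indicator-flip; count-resp; count-edges; count-edges-concatMap;
                                       decomposition⇒count≡1; count≡1⇒decomposition)
  open EdgeCount _≟W_ using () renaming (_≈?_ to _≈′?_; count to count′; indicator-flip to indicator-flip′; indicator-sym to indicator-sym′;
                                         count-edges to count-edges′; count≡0 to count≡0′; count-resp to count-resp′;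
                                         count-edges-concatMap to count-edges-concatMap′; count-edges-++ to count-edges-++′;
                                         decomposition⇒count≡1 to decomposition⇒count≡1′; count≡1⇒decomposition to count≡1⇒decomposition′)

  inM? : ∀ x → Dec (InM x)
  inM? x = Any.any? (x ≈?_) M

  InM-edgeM : ∀ {x} i → SameEdge x (edgeM i) → InM x
  InM-edgeM i = lose (∈-lookup i)

  edgeM-edge : ∀ i → IsEdge G (edgeM i)
  edgeM-edge i = All.lookup M⊆E (∈-lookup i)

  edgeM-injective : ∀ {i j} → SameEdge (edgeM i) (edgeM j) → i ≡ j
  edgeM-injective = distinct-lookup-injective M-distinct _ _

  Ends : Fin n → Fin n × Fin n → Set
  Ends u (s , t) = u ≡ s ⊎ u ≡ t

  ends : ∀ {u v x} → SameEdge (u , v) x → Ends u x × Ends v x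
  ends (inj₁ (refl , refl)) = inj₁ refl , inj₂ refl
  ends (inj₂ (refl , refl)) = inj₂ refl , inj₁ refl

  two-ends : ∀ {u v x} → u ≢ v → Ends u x → Ends v x → SameEdge (u , v) x
  two-ends u≢v (inj₁ refl) (inj₁ refl) = ⊥-elim (u≢v refl)
  two-ends u≢v (inj₁ refl) (inj₂ refl) = inj₁ (refl , refl)
  two-ends u≢v (inj₂ refl) (inj₁ refl) = inj₂ (refl , refl)
  two-ends u≢v (inj₂ refl) (inj₂ refl) = ⊥-elim (u≢v refl)

  other : Fin n → Fin n × Fin n → Fin n
  other u (s , t) with u Fin.≟ s
  ... | yes _ = t
  ... | no _ = s

  other-SameEdge : ∀ {u x} → Ends u x → SameEdge (u , other u x) x
  other-SameEdge {u} {s , t} u∈x with u Fin.≟ s | u∈x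
  ... | yes refl | _ = inj₁ (refl , refl)
  ... | no u≢s | inj₁ u≡s = ⊥-elim (u≢s u≡s)
  ... | no _ | inj₂ refl = inj₂ (refl , refl)

  edgeM-irreflexive : ∀ i → proj₁ (edgeM i) ≢ proj₂ (edgeM i)
  edgeM-irreflexive i eq = irref G (subst (λ u → Adj G u (proj₂ (edgeM i))) eq (edgeM-edge i))

  fishOf : Fin (length M) → CF → W
  fishOf i p = fish i p

  fishOf-injective : ∀ {i p q} → fishOf i p ≡ fishOf i q → p ≡ q
  fishOf-injective refl = refl

  fishEdges : Fin (length M) → List (W × W)
  fishEdges i = map (mapEdge (fishOf i)) cfEdges

  hub₁ hub₂ : Fin (length M) → W × W
  hub₁ i = base (proj₁ (edgeM i)) , fish i f
  hub₂ i = base (proj₂ (edgeM i)) , fish i f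

  hubIndicator : Fin (length M) → W × W → ℕ
  hubIndicator i z = indicator (hub₁ i ≈′? z) + indicator (hub₂ i ≈′? z)

  hubIndicator-flip : ∀ i x y → hubIndicator i (x , y) ≡ hubIndicator i (y , x)
  hubIndicator-flip i x y = cong₂ _+_ (indicator-flip′ (hub₁ i) x y) (indicator-flip′ (hub₂ i) x y)

  data Edge′ : W × W → Set where
    base-edge : ∀ {u v} → Adj G u v → ¬ InM (u , v) → Edge′ (base u , base v)
    hub-edge  : ∀ {u i} → Ends u (edgeM i) → Edge′ (base u , fish i f)
    fish-edge : ∀ {i p q} → T (cfAdj p q) → Edge′ (fish i p , fish i q)

  edge′ : ∀ {x y} → Adj G′ x y → Edge′ (x , y) ⊎ Edge′ (y , x)
  edge′ {base u} {base v} (uv , uv∉M) = inj₁ (base-edge uv uv∉M)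
  edge′ {base u} {fish i f} u∈i = inj₁ (hub-edge u∈i)
  edge′ {fish i f} {base u} u∈i = inj₂ (hub-edge u∈i)
  edge′ {fish i p} {fish .i q} (refl , pq) = inj₁ (fish-edge pq)
  edge′ {base _} {fish _ a} ()
  edge′ {base _} {fish _ b} ()
  edge′ {base _} {fish _ c} ()
  edge′ {base _} {fish _ d} ()
  edge′ {base _} {fish _ e} ()
  edge′ {fish _ a} {base _} ()
  edge′ {fish _ b} {base _} ()
  edge′ {fish _ c} {base _} ()
  edge′ {fish _ d} {base _} ()
  edge′ {fish _ e} {base _} ()

  by-orientation : {P : W × W → Set} → (∀ {x y} → P (x , y) → P (y , x)) →
                   (∀ {z} → Edge′ z → P z) → ∀ {x y} → Adj G′ x y → P (x , y)
  by-orientation flip P-oriented xy with edge′ xy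
  ... | inj₁ ez = P-oriented ez
  ... | inj₂ ez = flip (P-oriented ez)

  origin : W × W → Fin n × Fin n
  origin (base u , base v) = u , v
  origin (base _ , fish j _) = edgeM j
  origin (fish j _ , _) = edgeM j

  origin-edge : ∀ {z} → Edge′ z → IsEdge G (origin z)
  origin-edge (base-edge uv _) = uv
  origin-edge (hub-edge {i = i} _) = edgeM-edge i
  origin-edge (fish-edge {i} _) = edgeM-edge i

  indicator-edgeM : ∀ j i → indicator (edgeM j ≈? edgeM i) ≡ indicator (j Fin.≟ i)
  indicator-edgeM j i = indicator-cong (edgeM j ≈? edgeM i) (j Fin.≟ i) edgeM-injective λ { refl → SameEdge-refl _ }

  hubIndicator-base : ∀ i {u v} → hubIndicator i (base u , base v) ≡ 0
  hubIndicator-base i {u} {v} = cong₂ _+_ (indicator-no (hub₁ i ≈′? (base u , base v)) λ { (inj₁ (_ , ())) ; (inj₂ (_ , ())) })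
                                  (indicator-no (hub₂ i ≈′? (base u , base v)) λ { (inj₁ (_ , ())) ; (inj₂ (_ , ())) })

  hubIndicator-fish : ∀ i {j p q} → hubIndicator i (fish j p , fish j q) ≡ 0
  hubIndicator-fish i {j} {p} {q} = cong₂ _+_ (indicator-no (hub₁ i ≈′? (fish j p , fish j q)) λ { (inj₁ (() , _)) ; (inj₂ (() , _)) })
                                  (indicator-no (hub₂ i ≈′? (fish j p , fish j q)) λ { (inj₁ (() , _)) ; (inj₂ (() , _)) })

  hubIndicator-hub : ∀ i {u j} → Ends u (edgeM j) → hubIndicator i (base u , fish j f) ≡ indicator (j Fin.≟ i)
  hubIndicator-hub i {u} {j} u∈j with j Fin.≟ i
  ... | no j≢i = cong₂ _+_ (indicator-no (hub₁ i ≈′? (base u , fish j f)) other-copy)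
                           (indicator-no (hub₂ i ≈′? (base u , fish j f)) other-copy)
    where
    other-copy : ∀ {x} → ¬ SameEdge (x , fish i f) (base u , fish j f)
    other-copy (inj₁ (_ , eq)) = j≢i (≡.sym (cong proj₁ (inj₂-injective eq)))
    other-copy (inj₂ (_ , ()))
  ... | yes refl with u∈j
  ...   | inj₁ refl = cong₂ _+_ (indicator-yes (hub₁ i ≈′? hub₁ i) (SameEdge-refl _))
                                (indicator-no (hub₂ i ≈′? hub₁ i) λ { (inj₁ (eq , _)) → edgeM-irreflexive i (≡.sym (inj₁-injective eq))
                                                             ; (inj₂ (() , _)) })
  ...   | inj₂ refl = cong₂ _+_ (indicator-no (hub₁ i ≈′? hub₂ i) λ { (inj₁ (eq , _)) → edgeM-irreflexive i (inj₁-injective eq)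
                                                             ; (inj₂ (() , _)) })
                                (indicator-yes (hub₂ i ≈′? hub₂ i) (SameEdge-refl _))

  fishEdges-base : ∀ i u y → count′ (base u , y) (fishEdges i) ≡ 0
  fishEdges-base i u y = count≡0′ (All.map⁺ (All.universal base≉fish cfEdges))
    where
    base≉fish : ∀ pq → ¬ SameEdge (base u , y) (mapEdge (fishOf i) pq)
    base≉fish _ (inj₁ (() , _))
    base≉fish _ (inj₂ (() , _))

  fishEdges-fish : ∀ i {j p q} → T (cfAdj p q) → count′ (fish j p , fish j q) (fishEdges i) ≡ indicator (j Fin.≟ i)
  fishEdges-fish i {j} {p} {q} pq = by-copy (j Fin.≟ i)
    where
    by-copy : (j≟i : Dec (j ≡ i)) → count′ (fish j p , fish j q) (fishEdges i) ≡ indicator j≟i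
    by-copy (yes refl) = trans (CountMap.count-map-reflect _≟CF_ _≟W_ (fishOf j) {p} {q} fishOf-injective fishOf-injective cfEdges)
                               (cfEdges-once p q pq)
    by-copy (no j≢i) = count≡0′ (All.map⁺ (All.universal other-copy cfEdges))
      where
      other-copy : ∀ pq → ¬ SameEdge (fish j p , fish j q) (mapEdge (fishOf i) pq)
      other-copy _ (inj₁ (eq , _)) = j≢i (cong proj₁ (inj₂-injective eq))
      other-copy _ (inj₂ (eq , _)) = j≢i (cong proj₁ (inj₂-injective eq))

  attached-count : ∀ i {z} → Edge′ z → hubIndicator i z + count′ z (fishEdges i) ≡ indicator (origin z ≈? edgeM i)
  attached-count i (base-edge {u} {v} _ uv∉M) =
    trans (cong₂ _+_ (hubIndicator-base i) (fishEdges-base i u (base v)))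
          (≡.sym (indicator-no ((u , v) ≈? edgeM i) λ uv≈i → uv∉M (InM-edgeM i uv≈i)))
  attached-count i (hub-edge {u} {j} u∈j) =
    trans (cong₂ _+_ (hubIndicator-hub i u∈j) (fishEdges-base i u (fish j f)))
          (trans (+-identityʳ _) (≡.sym (indicator-edgeM j i)))
  attached-count i (fish-edge {j} {p} {q} pq) =
    trans (cong (_+ count′ (fish j p , fish j q) (fishEdges i)) (hubIndicator-fish i {j} {p} {q}))
          (trans (fishEdges-fish i pq) (≡.sym (indicator-edgeM j i)))

  -- From decompositions of G to decompositions of G′

  data Spoke (u v : Fin n) : Set where
    plain    : ¬ InM (u , v) → Spoke u v
    attached : ∀ i → SameEdge (u , v) (edgeM i) → Spoke u v

  spoke : ∀ u v → Spoke u v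
  spoke u v with inM? (u , v)
  ... | yes uv∈M = attached (Any.index uv∈M) (lookup-index uv∈M)
  ... | no uv∉M = plain uv∉M

  tip : ∀ {u v} → Spoke u v → W
  tip {v = v} (plain _) = base v
  tip (attached i _) = fish i f

  -- Together with the hub edge v w these pieces cover the i-th co-fish exactly.
  coFish : Fin (length M) → Fin n → List (Piece W)
  coFish i v = path (base v) (fish i f) (fish i a) (fish i b) ∷ star (fish i d) (fish i a) (fish i c) (fish i e) ∷
               tri (fish i b) (fish i c) (fish i e) ∷ []

  gadget : ∀ {u v} → Spoke u v → List (Piece W)
  gadget (plain _) = []
  gadget {v = v} (attached i _) = coFish i v

  spokeEdges : ∀ {u v} → Spoke u v → List (W × W)
  spokeEdges {u} sp = (base u , tip sp) ∷ edges (gadget sp)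

  count-spoke : ∀ {u v} → u ≢ v → (sp : Spoke u v) → ∀ {z} → Edge′ z →
                count′ z (spokeEdges sp) ≡ indicator (origin z ≈? (u , v))
  count-spoke {u} {v} _ (plain uv∉M) (base-edge {s} {t} _ _) =
    trans (+-identityʳ _) (indicator-cong ((base s , base t) ≈′? (base u , base v)) ((s , t) ≈? (u , v))
                                          (SameEdge-map⁻ inj₁-injective) (SameEdge-map inj₁))
  count-spoke {u} {v} _ (plain uv∉M) (hub-edge {s} {j} _) =
    trans (+-identityʳ _) (trans (indicator-no ((base s , fish j f) ≈′? (base u , base v)) λ { (inj₁ (_ , ())) ; (inj₂ (_ , ())) })
      (≡.sym (indicator-no (edgeM j ≈? (u , v)) λ j≈uv → uv∉M (InM-edgeM j (SameEdge-sym j≈uv)))))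
  count-spoke {u} {v} _ (plain uv∉M) (fish-edge {j} {p} {q} _) =
    trans (+-identityʳ _) (trans (indicator-no ((fish j p , fish j q) ≈′? (base u , base v)) λ { (inj₁ (() , _)) ; (inj₂ (() , _)) })
      (≡.sym (indicator-no (edgeM j ≈? (u , v)) λ j≈uv → uv∉M (InM-edgeM j (SameEdge-sym j≈uv)))))
  count-spoke {u} {v} u≢v (attached i uv≈i) {z} ez = begin
    count′ z (spokeEdges (attached i uv≈i))     ≡⟨ hubs-first uv≈i ⟩
    hubIndicator i z + count′ z (fishEdges i)   ≡⟨ attached-count i ez ⟩
    indicator (origin z ≈? edgeM i)             ≡⟨ indicator-cong (origin z ≈? edgeM i) (origin z ≈? (u , v))
                                                     (λ ≈i → SameEdge-trans ≈i (SameEdge-sym uv≈i)) (λ ≈uv → SameEdge-trans ≈uv uv≈i) ⟩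
    indicator (origin z ≈? (u , v))             ∎
    where
    hubs-first : ∀ {u v} → SameEdge (u , v) (edgeM i) →
                 count′ z ((base u , fish i f) ∷ (base v , fish i f) ∷ fishEdges i) ≡ hubIndicator i z + count′ z (fishEdges i)
    hubs-first (inj₁ (refl , refl)) =
      trans (cong₂ (λ h₁ h₂ → h₁ + (h₂ + count′ z (fishEdges i))) (indicator-sym′ z (hub₁ i)) (indicator-sym′ z (hub₂ i)))
            (≡.sym (+-assoc (indicator (hub₁ i ≈′? z)) (indicator (hub₂ i ≈′? z)) (count′ z (fishEdges i))))
    hubs-first (inj₂ (refl , refl)) =
      trans (cong₂ (λ h₂ h₁ → h₂ + (h₁ + count′ z (fishEdges i))) (indicator-sym′ z (hub₂ i)) (indicator-sym′ z (hub₁ i)))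
            (swap-front (indicator (hub₂ i ≈′? z)) (indicator (hub₁ i ≈′? z)) (count′ z (fishEdges i)))
      where
      swap-front : ∀ x y r → x + (y + r) ≡ (y + x) + r
      swap-front = solve-∀

  S₂ S₃ : List Shape
  S₂ = K13 ∷ P4 ∷ []
  S₃ = K13 ∷ K3 ∷ P4 ∷ []

  lift : Piece (Fin n) → List (Piece W)
  lift (star w x y z) = star (base w) (tip (spoke w x)) (tip (spoke w y)) (tip (spoke w z))
                        ∷ gadget (spoke w x) ++ gadget (spoke w y) ++ gadget (spoke w z)
  lift (tri _ _ _) = []
  lift (path w x y z) = path (tip (spoke x w)) (base x) (base y) (tip (spoke y z)) ∷ gadget (spoke x w) ++ gadget (spoke y z)

  count-lift : ∀ p → shapeOf p ∈ S₂ → ValidPiece G p → ¬ MiddleIn M p → ∀ {ζ} → Edge′ ζ →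
               count′ ζ (edges (lift p)) ≡ count (origin ζ) (pieceEdges p)
  count-lift (star w x y z) _ ((w≢x , w≢y , w≢z , _) , _) _ {ζ} eζ = begin
    I₁ + (I₂ + (I₃ + count′ ζ (edges (gadget sx ++ gadget sy ++ gadget sz))))
      ≡⟨ cong (λ k → I₁ + (I₂ + (I₃ + k))) (trans (count-edges-++′ ζ (gadget sx) _) (cong (C sx +_) (count-edges-++′ ζ (gadget sy) _))) ⟩
    I₁ + (I₂ + (I₃ + (C sx + (C sy + C sz))))
      ≡⟨ regroup I₁ I₂ I₃ (C sx) (C sy) (C sz) ⟩
    count′ ζ (spokeEdges sx) + (count′ ζ (spokeEdges sy) + (count′ ζ (spokeEdges sz) + 0))
      ≡⟨ cong₂ _+_ (count-spoke w≢x sx eζ) (cong₂ _+_ (count-spoke w≢y sy eζ) (cong (_+ 0) (count-spoke w≢z sz eζ))) ⟩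
    count (origin ζ) (pieceEdges (star w x y z))
      ∎
    where
    sx : Spoke w x
    sx = spoke w x
    sy : Spoke w y
    sy = spoke w y
    sz : Spoke w z
    sz = spoke w z
    I₁ I₂ I₃ : ℕ
    I₁ = indicator (ζ ≈′? (base w , tip sx))
    I₂ = indicator (ζ ≈′? (base w , tip sy))
    I₃ = indicator (ζ ≈′? (base w , tip sz))
    C : ∀ {u} → Spoke w u → ℕ
    C sp = count′ ζ (edges (gadget sp))
    regroup : ∀ i₁ i₂ i₃ k₁ k₂ k₃ → i₁ + (i₂ + (i₃ + (k₁ + (k₂ + k₃)))) ≡ (i₁ + k₁) + ((i₂ + k₂) + ((i₃ + k₃) + 0))
    regroup = solve-∀
  count-lift (path w x y z) _ ((w≢x , _ , _ , x≢y , _ , y≢z) , _) xy∉M {ζ} eζ = begin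
    J₁ + (J₂ + (J₃ + count′ ζ (edges (gadget sxw ++ gadget syz))))
      ≡⟨ cong (λ k → J₁ + (J₂ + (J₃ + k))) (count-edges-++′ ζ (gadget sxw) _) ⟩
    J₁ + (J₂ + (J₃ + (C₁ + C₂)))
      ≡⟨ regroup J₁ J₂ J₃ C₁ C₂ ⟩
    (J₁ + C₁) + ((J₂ + 0) + ((J₃ + C₂) + 0))
      ≡⟨ cong (λ k → (k + C₁) + ((J₂ + 0) + ((J₃ + C₂) + 0))) (indicator-flip′ ζ (tip sxw) (base x)) ⟩
    count′ ζ (spokeEdges sxw) + (count′ ζ (spokeEdges (plain xy∉M)) + (count′ ζ (spokeEdges syz) + 0))
      ≡⟨ cong₂ _+_ (trans (count-spoke (λ x≡w → w≢x (≡.sym x≡w)) sxw eζ) (indicator-flip (origin ζ) x w))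
                   (cong₂ _+_ (count-spoke x≢y (plain xy∉M) eζ) (cong (_+ 0) (count-spoke y≢z syz eζ))) ⟩
    count (origin ζ) (pieceEdges (path w x y z))
      ∎
    where
    sxw : Spoke x w
    sxw = spoke x w
    syz : Spoke y z
    syz = spoke y z
    J₁ J₂ J₃ C₁ C₂ : ℕ
    J₁ = indicator (ζ ≈′? (tip sxw , base x))
    J₂ = indicator (ζ ≈′? (base x , base y))
    J₃ = indicator (ζ ≈′? (base y , tip syz))
    C₁ = count′ ζ (edges (gadget sxw))
    C₂ = count′ ζ (edges (gadget syz))
    regroup : ∀ j₁ j₂ j₃ k₁ k₂ → j₁ + (j₂ + (j₃ + (k₁ + k₂))) ≡ (j₁ + k₁) + ((j₂ + 0) + ((j₃ + k₂) + 0))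
    regroup = solve-∀
  count-lift (tri _ _ _) (here ())
  count-lift (tri _ _ _) (there (here ()))
  count-lift (tri _ _ _) (there (there ()))

  tip-edge : ∀ {u v} → Adj G u v → (sp : Spoke u v) → Adj G′ (base u) (tip sp)
  tip-edge uv (plain uv∉M) = uv , uv∉M
  tip-edge _ (attached _ uv≈i) = proj₁ (ends uv≈i)

  tip≡base : ∀ {u v y} (sp : Spoke u v) → tip sp ≡ base y → v ≡ y
  tip≡base (plain _) refl = refl

  tip-injective : ∀ {u v u′ v′} (sp : Spoke u v) (sq : Spoke u′ v′) → tip sp ≡ tip sq → v ≡ v′ ⊎ SameEdge (u , v) (u′ , v′)
  tip-injective (plain _) (plain _) refl = inj₁ refl
  tip-injective (attached i uv≈i) (attached .i uv≈i′) refl = inj₂ (SameEdge-trans uv≈i (SameEdge-sym uv≈i′))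

  gadget-valid : ∀ {u v} (sp : Spoke u v) → All (ValidIn G′ S₃) (gadget sp)
  gadget-valid (plain _) = []
  gadget-valid (attached i uv≈i) =
    (there (there (here refl)) , ((λ ()) , (λ ()) , (λ ()) , (λ ()) , (λ ()) , (λ ())) , proj₂ (ends uv≈i) , (refl , tt) , (refl , tt)) ∷
    (here refl , ((λ ()) , (λ ()) , (λ ()) , (λ ()) , (λ ()) , (λ ())) , (refl , tt) , (refl , tt) , (refl , tt)) ∷
    (there (here refl) , ((λ ()) , (λ ()) , (λ ())) , (refl , tt) , (refl , tt) , (refl , tt)) ∷ []

  lift-valid : ∀ p → shapeOf p ∈ S₂ → ValidPiece G p → ¬ MiddleIn M p → All (ValidIn G′ S₃) (lift p)
  lift-valid (star w x y z) _ ((w≢x , w≢y , w≢z , x≢y , x≢z , y≢z) , wx , wy , wz) _ =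
    (here refl , (base≢tip w≢x sx , base≢tip w≢y sy , base≢tip w≢z sz ,
                  tips≢ x≢y w≢y sx sy , tips≢ x≢z w≢z sx sz , tips≢ y≢z w≢z sy sz) ,
                 tip-edge wx sx , tip-edge wy sy , tip-edge wz sz) ∷
    All.++⁺ (gadget-valid sx) (All.++⁺ (gadget-valid sy) (gadget-valid sz))
    where
    sx : Spoke w x
    sx = spoke w x
    sy : Spoke w y
    sy = spoke w y
    sz : Spoke w z
    sz = spoke w z
    base≢tip : ∀ {v} → w ≢ v → (sp : Spoke w v) → base w ≢ tip sp
    base≢tip w≢v sp eq = w≢v (≡.sym (tip≡base sp (≡.sym eq)))
    tips≢ : ∀ {v v′} → v ≢ v′ → w ≢ v′ → (sp : Spoke w v) (sq : Spoke w v′) → tip sp ≢ tip sq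
    tips≢ v≢v′ w≢v′ sp sq eq with tip-injective sp sq eq
    ... | inj₁ v≡v′ = v≢v′ v≡v′
    ... | inj₂ (inj₁ (_ , v≡v′)) = v≢v′ v≡v′
    ... | inj₂ (inj₂ (w≡v′ , _)) = w≢v′ w≡v′
  lift-valid (path w x y z) _ ((w≢x , w≢y , w≢z , x≢y , x≢z , y≢z) , wx , xy , yz) xy∉M =
    (there (there (here refl)) ,
      ((λ eq → w≢x (tip≡base sxw eq)) , (λ eq → w≢y (tip≡base sxw eq)) , ends≢ ,
       (λ eq → x≢y (inj₁-injective eq)) ,
       (λ eq → x≢z (≡.sym (tip≡base syz (≡.sym eq)))) ,
       (λ eq → y≢z (≡.sym (tip≡base syz (≡.sym eq))))) ,
      sym G′ {base x} {tip sxw} (tip-edge (sym G wx) sxw) , (xy , xy∉M) , tip-edge yz syz) ∷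
    All.++⁺ (gadget-valid sxw) (gadget-valid syz)
    where
    sxw : Spoke x w
    sxw = spoke x w
    syz : Spoke y z
    syz = spoke y z
    ends≢ : tip sxw ≢ tip syz
    ends≢ eq with tip-injective sxw syz eq
    ... | inj₁ w≡z = w≢z w≡z
    ... | inj₂ (inj₁ (x≡y , _)) = x≢y x≡y
    ... | inj₂ (inj₂ (x≡z , _)) = x≢z x≡z
  lift-valid (tri _ _ _) (here ())
  lift-valid (tri _ _ _) (there (here ()))
  lift-valid (tri _ _ _) (there (there ()))

  forward : ∀ {ps} → Decomposition G S₂ ps → All (λ p → ¬ MiddleIn M p) ps → Decomposition G′ S₃ (concatMap lift ps)
  forward {ps} D@(valid , _) no-middle = count≡1⇒decomposition′ G′ S₃
    (All.concat⁺ (All.map⁺ (All.zipWith (λ {p} ((S₂∋p , p-valid) , p-ok) → lift-valid p S₂∋p p-valid p-ok) (valid , no-middle))))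
    (by-orientation (λ once → trans (count-resp′ (edges (concatMap lift ps)) (inj₂ (refl , refl))) once) once)
    where
    once : ∀ {ζ} → Edge′ ζ → count′ ζ (edges (concatMap lift ps)) ≡ 1
    once {ζ} eζ = begin
      count′ ζ (edges (concatMap lift ps))          ≡⟨ count-edges-concatMap′ ζ lift ps ⟩
      ∑ (λ p → count′ ζ (edges (lift p))) ps        ≡⟨ ∑-cong-All (All.zipWith (λ {p} ((S₂∋p , p-valid) , p-ok) → count-lift p S₂∋p p-valid p-ok eζ)
                                                                             (valid , no-middle)) ⟩
      ∑ (λ p → count (origin ζ) (pieceEdges p)) ps  ≡⟨ count-edges (origin ζ) ps ⟨
      count (origin ζ) (edges ps)                   ≡⟨ decomposition⇒count≡1 G S₂ D (origin-edge eζ) ⟩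
      1                                             ∎

  -- From decompositions of G′ to decompositions of G

  roleIn : ∀ {i j : Fin (length M)} → Dec (j ≡ i) → CF → Role
  roleIn (yes _) p = own p
  roleIn (no _) _ = alien

  role : Fin (length M) → W → Role
  role i (base _) = old
  role i (fish j p) = roleIn (j Fin.≟ i) p

  rolePiece : Fin (length M) → Piece W → Piece Role
  rolePiece i = mapPiece (role i)

  role-own : ∀ i p → role i (fish i p) ≡ own p
  role-own i p with i Fin.≟ i
  ... | yes _ = refl
  ... | no i≢i = ⊥-elim (i≢i refl)

  role≡own : ∀ i {x p} → role i x ≡ own p → x ≡ fish i p
  role≡own i {fish j q} = by-copy (j Fin.≟ i)
    where
    by-copy : (j≟i : Dec (j ≡ i)) → roleIn j≟i q ≡ own _ → fish j q ≡ fish i _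
    by-copy (yes refl) refl = refl

  roleIn≢old : ∀ {i j} (j≟i : Dec (j ≡ i)) p → roleIn j≟i p ≢ old
  roleIn≢old (yes _) _ ()
  roleIn≢old (no _) _ ()

  role-edge : ∀ i {x y} → Adj G′ x y → RoleEdge (role i x , role i y)
  role-edge i {base _} {base _} _ = tt
  role-edge i {base _} {fish j f} _ = by-copy (j Fin.≟ i)
    where
    by-copy : (j≟i : Dec (j ≡ i)) → RoleEdge (old , roleIn j≟i f)
    by-copy (yes _) = tt
    by-copy (no _) = tt
  role-edge i {fish j f} {base _} _ = by-copy (j Fin.≟ i)
    where
    by-copy : (j≟i : Dec (j ≡ i)) → RoleEdge (roleIn j≟i f , old)
    by-copy (yes _) = tt
    by-copy (no _) = tt
  role-edge i {fish j p} {fish .j q} (refl , pq) = by-copy (j Fin.≟ i)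
    where
    by-copy : (j≟i : Dec (j ≡ i)) → RoleEdge (roleIn j≟i p , roleIn j≟i q)
    by-copy (yes _) = pq
    by-copy (no _) = tt

  roles-valid : ∀ i p → ValidPiece G′ p → ValidRoles (rolePiece i p)
  roles-valid i p valid = subst (All RoleEdge) (≡.sym (pieceEdges-mapPiece (role i) p))
                                (All.map⁺ (All.map (λ {xy} → role-edge i {proj₁ xy} {proj₂ xy}) (valid⇒edges G′ p valid)))

  faOf hubsOf innerOf : Fin (length M) → Piece W → ℕ
  faOf i p = count′ (fish i f , fish i a) (pieceEdges p)
  hubsOf i p = ∑ (hubIndicator i) (pieceEdges p)
  innerOf i p = ∑ (λ pq → count′ (mapEdge (fishOf i) pq) (pieceEdges p)) cfEdges

  private
    module RW i = CountMap _≟W_ _≟R_ (role i)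

  count-role : ∀ i p q ys → countR (own p , own q) (map (mapEdge (role i)) ys) ≡ count′ (fish i p , fish i q) ys
  count-role i p q ys = begin
    countR (own p , own q) (map (mapEdge (role i)) ys)
      ≡⟨ cong₂ (λ x y → countR (x , y) (map (mapEdge (role i)) ys)) (role-own i p) (role-own i q) ⟨
    countR (role i (fish i p) , role i (fish i q)) (map (mapEdge (role i)) ys)
      ≡⟨ RW.count-map-reflect i (λ eq → role≡own i (trans eq (role-own i p))) (λ eq → role≡own i (trans eq (role-own i q))) ys ⟩
    count′ (fish i p , fish i q) ys
      ∎

  edges-rolePiece : ∀ i p → pieceEdges (rolePiece i p) ≡ map (mapEdge (role i)) (pieceEdges p)
  edges-rolePiece i = pieceEdges-mapPiece (role i)

  faCount-role : ∀ i p → faCount (rolePiece i p) ≡ faOf i p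
  faCount-role i p = trans (cong (countR (own f , own a)) (edges-rolePiece i p)) (count-role i f a (pieceEdges p))

  innerCount-role : ∀ i p → innerCount (rolePiece i p) ≡ innerOf i p
  innerCount-role i p = ∑-cong (λ (q , r) → trans (cong (countR (own q , own r)) (edges-rolePiece i p))
                                                    (count-role i q r (pieceEdges p))) cfEdges

  hub-role : ∀ i {x y} → Adj G′ x y → indicator ((old , own f) ≈R? (role i x , role i y)) ≡ hubIndicator i (x , y)
  hub-role i {x} {y} =
    by-orientation {P = λ z → indicator ((old , own f) ≈R? mapEdge (role i) z) ≡ hubIndicator i z}
                   (λ {x} {y} → flip {x} {y}) oriented {x} {y}
    where
    flip : ∀ {x y} → indicator ((old , own f) ≈R? (role i x , role i y)) ≡ hubIndicator i (x , y) →
           indicator ((old , own f) ≈R? (role i y , role i x)) ≡ hubIndicator i (y , x)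
    flip {x} {y} eq = trans (indicator-flipR (old , own f) (role i y) (role i x))
                       (trans eq (hubIndicator-flip i x y))
    oriented : ∀ {z} → Edge′ z → indicator ((old , own f) ≈R? mapEdge (role i) z) ≡ hubIndicator i z
    oriented (base-edge _ _) = trans (indicator-no ((old , own f) ≈R? (old , old)) λ { (inj₁ (_ , ())) ; (inj₂ (_ , ())) })
                                     (≡.sym (hubIndicator-base i))
    oriented (hub-edge {i = j} u∈j) = trans (by-copy (j Fin.≟ i)) (≡.sym (hubIndicator-hub i u∈j))
      where
      by-copy : (j≟i : Dec (j ≡ i)) → indicator ((old , own f) ≈R? (old , roleIn j≟i f)) ≡ indicator j≟i
      by-copy (yes _) = indicator-yes ((old , own f) ≈R? (old , own f)) (SameEdge-refl _)
      by-copy (no _) = indicator-no ((old , own f) ≈R? (old , alien)) λ { (inj₁ (_ , ())) ; (inj₂ (() , _)) }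
    oriented (fish-edge {j} {p} {q} _) =
      trans (indicator-no ((old , own f) ≈R? (roleIn (j Fin.≟ i) p , roleIn (j Fin.≟ i) q))
                          λ { (inj₁ (eq , _)) → roleIn≢old (j Fin.≟ i) p (≡.sym eq)
                            ; (inj₂ (eq , _)) → roleIn≢old (j Fin.≟ i) q (≡.sym eq) })
            (≡.sym (hubIndicator-fish i {j} {p} {q}))

  hubCount-role : ∀ i p → ValidPiece G′ p → hubCount (rolePiece i p) ≡ hubsOf i p
  hubCount-role i p valid = begin
    countR (old , own f) (pieceEdges (rolePiece i p))                              ≡⟨ cong (countR (old , own f)) (edges-rolePiece i p) ⟩
    countR (old , own f) (map (mapEdge (role i)) (pieceEdges p))                   ≡⟨ ∑-map _ (mapEdge (role i)) (pieceEdges p) ⟩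
    ∑ (λ z → indicator ((old , own f) ≈R? mapEdge (role i) z)) (pieceEdges p)     ≡⟨ ∑-cong-All (All.map (λ {z} → hub-role i {proj₁ z} {proj₂ z})
                                                                                                            (valid⇒edges G′ p valid)) ⟩
    hubsOf i p                                                                     ∎

  oldCount-role : ∀ i p → oldCount (rolePiece i p) ≡ 0 → ∀ u v → count′ (base u , base v) (pieceEdges p) ≡ 0
  oldCount-role i p none u v = ℕ.n≤0⇒n≡0 (≤-trans (RW.count-map-≤ i (base u , base v) (pieceEdges p))
    (≤-reflexive (trans (cong (countR (old , old)) (≡.sym (edges-rolePiece i p))) none)))

  alien-free⇒own-free : ∀ {i j} → j ≢ i → ∀ x → role j x ≢ alien → ¬ IsOwn (role i x)
  alien-free⇒own-free _ (base _) _ ()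
  alien-free⇒own-free {i} {j} j≢i (fish k p) = by-copy (k Fin.≟ j) (k Fin.≟ i)
    where
    by-copy : (k≟j : Dec (k ≡ j)) (k≟i : Dec (k ≡ i)) → roleIn k≟j p ≢ alien → ¬ IsOwn (roleIn k≟i p)
    by-copy (yes refl) (yes refl) _ = ⊥-elim (j≢i refl)
    by-copy (no _) (yes _) not-alien = ⊥-elim (not-alien refl)
    by-copy _ (no _) _ ()

  base-fish⇒hub : ∀ {u j p} → Adj G′ (base u) (fish j p) → p ≡ f × Ends u (edgeM j)
  base-fish⇒hub {p = f} u∈j = refl , u∈j
  base-fish⇒hub {p = a} ()
  base-fish⇒hub {p = b} ()
  base-fish⇒hub {p = c} ()
  base-fish⇒hub {p = d} ()
  base-fish⇒hub {p = e} ()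

  -- A neighbour of base u in G′ read as a neighbour of u in G: the subdivision vertex of an
  -- edge of M stands for the other end of that edge.
  project : Fin n → W → Fin n
  project u (base v) = v
  project u (fish j _) = other u (edgeM j)

  project-edge : ∀ {u} z → Adj G′ (base u) z → Adj G u (project u z)
  project-edge (base _) (uv , _) = uv
  project-edge (fish j _) hub with base-fish⇒hub hub
  ... | refl , u∈j = IsEdge-resp G (SameEdge-sym (other-SameEdge u∈j)) (edgeM-edge j)

  project-injective : ∀ {u} z z′ → Adj G′ (base u) z → Adj G′ (base u) z′ → project u z ≡ project u z′ → z ≡ z′
  project-injective (base _) (base _) _ _ refl = refl
  project-injective (base _) (fish j _) (_ , uv∉M) hub refl with base-fish⇒hub hub
  ... | _ , u∈j = ⊥-elim (uv∉M (InM-edgeM j (other-SameEdge u∈j)))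
  project-injective (fish j _) (base _) hub (_ , uv∉M) eq with base-fish⇒hub hub
  ... | _ , u∈j = ⊥-elim (uv∉M (InM-edgeM j (subst (λ v → SameEdge (_ , v) (edgeM j)) eq (other-SameEdge u∈j))))
  project-injective {u} (fish j _) (fish k _) hub hub′ eq with base-fish⇒hub hub | base-fish⇒hub hub′
  ... | refl , u∈j | refl , u∈k =
    cong (λ i → fish i f) (edgeM-injective (SameEdge-trans (SameEdge-sym (other-SameEdge u∈j))
                                           (subst (λ v → SameEdge (u , v) (edgeM k)) (≡.sym eq) (other-SameEdge u∈k))))

  hitM : Fin (length M) → Fin n × Fin n → ℕ
  hitM i uv = indicator (edgeM i ≈? uv)

  hitFa : Fin (length M) → W × W → ℕ
  hitFa i z = indicator ((fish i f , fish i a) ≈′? z)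

  project-count : ∀ {y u} z → ¬ InM y → Adj G′ (base u) z → indicator (y ≈? (u , project u z)) ≡ indicator (mapEdge inj₁ y ≈′? (base u , z))
  project-count {y} {u} (base v) _ _ = indicator-cong (y ≈? (u , v)) (mapEdge inj₁ y ≈′? (base u , base v))
                                                     (SameEdge-map inj₁) (SameEdge-map⁻ inj₁-injective)
  project-count {y} {u} (fish j p) y∉M hub with base-fish⇒hub hub
  ... | refl , u∈j = trans (indicator-no (y ≈? _) λ y≈ → y∉M (InM-edgeM j (SameEdge-trans y≈ (other-SameEdge u∈j))))
                           (≡.sym (indicator-no (mapEdge inj₁ y ≈′? (base u , fish j f)) λ { (inj₁ (_ , ())) ; (inj₂ (() , _)) }))

  project-hub : ∀ i {u} z → Adj G′ (base u) z → hitM i (u , project u z) + hitFa i (base u , z) ≡ hubIndicator i (base u , z)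
  project-hub i {u} (base v) (_ , uv∉M) =
    trans (cong₂ _+_ (indicator-no (edgeM i ≈? (u , v)) λ i≈uv → uv∉M (InM-edgeM i (SameEdge-sym i≈uv)))
                     (indicator-no ((fish i f , fish i a) ≈′? (base u , base v)) λ { (inj₁ (() , _)) ; (inj₂ (() , _)) }))
          (≡.sym (hubIndicator-base i))
  project-hub i {u} (fish j p) hub with base-fish⇒hub hub
  ... | refl , u∈j = begin
    indicator (edgeM i ≈? (u , other u (edgeM j))) + indicator ((fish i f , fish i a) ≈′? (base u , fish j f))
      ≡⟨ cong₂ _+_ (indicator-cong (edgeM i ≈? _) (edgeM j ≈? edgeM i)
                      (λ i≈ → SameEdge-sym (SameEdge-trans i≈ (other-SameEdge u∈j)))
                      (λ j≈i → SameEdge-trans (SameEdge-sym j≈i) (SameEdge-sym (other-SameEdge u∈j))))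
                   (indicator-no ((fish i f , fish i a) ≈′? _) λ { (inj₁ (() , _)) ; (inj₂ (_ , ())) }) ⟩
    indicator (edgeM j ≈? edgeM i) + 0
      ≡⟨ trans (+-identityʳ _) (indicator-edgeM j i) ⟩
    indicator (j Fin.≟ i)
      ≡⟨ hubIndicator-hub i u∈j ⟨
    hubIndicator i (base u , fish j f)
      ∎

  project-count˘ : ∀ {y u} z → ¬ InM y → Adj G′ (base u) z →
                   indicator (y ≈? (project u z , u)) ≡ indicator (mapEdge inj₁ y ≈′? (z , base u))
  project-count˘ {y} {u} z y∉M uz =
    trans (indicator-flip y (project u z) u) (trans (project-count z y∉M uz) (indicator-flip′ (mapEdge inj₁ y) (base u) z))

  project-hub˘ : ∀ i {u} z → Adj G′ (base u) z → hitM i (project u z , u) + hitFa i (z , base u) ≡ hubIndicator i (z , base u)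
  project-hub˘ i {u} z uz =
    trans (cong₂ _+_ (indicator-flip (edgeM i) (project u z) u) (indicator-flip′ (fish i f , fish i a) z (base u)))
          (trans (project-hub i z uz) (hubIndicator-flip i (base u) z))

  own-in : ∀ j p → IsOwn (role j (fish j p))
  own-in j p = subst IsOwn (≡.sym (role-own j p)) tt

  triangle-in-copy : K3Free G → ∀ {x y z} → Adj G′ x y → Adj G′ y z → Adj G′ x z →
                     Σ (Fin (length M)) λ j → IsOwn (role j x) × IsOwn (role j y) × IsOwn (role j z)
  triangle-in-copy k3 {base u} {base v} {base w} (uv , _) (vw , _) (uw , _) = ⊥-elim (k3 (u , v , w , uv , vw , uw))
  triangle-in-copy k3 {base u} {base v} {fish j _} (uv , uv∉M) vz uz =
    ⊥-elim (uv∉M (InM-edgeM j (two-ends (λ { refl → irref G uv }) (proj₂ (base-fish⇒hub uz)) (proj₂ (base-fish⇒hub vz)))))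
  triangle-in-copy k3 {base u} {fish j _} {base w} uy yw (uw , uw∉M) =
    ⊥-elim (uw∉M (InM-edgeM j (two-ends (λ { refl → irref G uw }) (proj₂ (base-fish⇒hub uy)) (proj₂ (base-fish⇒hub yw)))))
  triangle-in-copy k3 {fish j _} {base v} {base w} xv (vw , vw∉M) xw =
    ⊥-elim (vw∉M (InM-edgeM j (two-ends (λ { refl → irref G vw }) (proj₂ (base-fish⇒hub xv)) (proj₂ (base-fish⇒hub xw)))))
  triangle-in-copy k3 {base _} {fish _ _} {fish _ _} uy yz uz with base-fish⇒hub uy | base-fish⇒hub uz
  ... | refl , _ | refl , _ = ⊥-elim (proj₂ yz)
  triangle-in-copy k3 {fish _ _} {base _} {fish _ _} xv vz xz with base-fish⇒hub xv | base-fish⇒hub vz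
  ... | refl , _ | refl , _ = ⊥-elim (proj₂ xz)
  triangle-in-copy k3 {fish _ _} {fish _ _} {base _} xy yw xw with base-fish⇒hub xw | base-fish⇒hub yw
  ... | refl , _ | refl , _ = ⊥-elim (proj₂ xy)
  triangle-in-copy k3 {fish j p} {fish .j q} {fish .j r} (refl , _) (refl , _) _ = j , own-in j p , own-in j q , own-in j r

  restrict : Piece W → List (Piece (Fin n))
  restrict (star (base w) x y z) = star w (project w x) (project w y) (project w z) ∷ []
  restrict (path w (base x) (base y) z) = path (project x w) x y (project y z) ∷ []
  restrict _ = []

  data Restriction : Piece W → Set where
    kept-star : ∀ w x y z → Restriction (star (base w) x y z)
    kept-path : ∀ w x y z → Restriction (path w (base x) (base y) z)
    dropped   : ∀ {p} j → InCopy (rolePiece j p) → restrict p ≡ [] → Restriction p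

  restriction : K3Free G → ∀ p → ValidPiece G′ p → Restriction p
  restriction _ (star (base w) x y z) _ = kept-star w x y z
  restriction _ (star (fish j p) _ _ _) _ = dropped j (own-in j p) refl
  restriction k3 (tri x y z) (_ , xy , yz , xz) with triangle-in-copy k3 {x} {y} {z} xy yz xz
  ... | j , own-x , own-y , own-z = dropped j (own-x , own-y , own-z) refl
  restriction _ (path w (base x) (base y) z) _ = kept-path w x y z
  restriction _ (path _ (fish j p) _ _) _ = dropped j (inj₁ (own-in j p)) refl
  restriction _ (path _ (base _) (fish j p) _) _ = dropped j (inj₂ (own-in j p)) refl

  restrict-valid : K3Free G → ∀ p → ValidPiece G′ p → All (λ q → ValidIn G S₂ q × ¬ MiddleIn M q) (restrict p)
  restrict-valid _ (star (base w) x y z) ((_ , _ , _ , x≢y , x≢z , y≢z) , wx , wy , wz) =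
    ((here refl , (centre≢ x wx , centre≢ y wy , centre≢ z wz ,
                   leaves≢ x y x≢y wx wy , leaves≢ x z x≢z wx wz , leaves≢ y z y≢z wy wz) ,
                  project-edge x wx , project-edge y wy , project-edge z wz) , λ ()) ∷ []
    where
    centre≢ : ∀ v → Adj G′ (base w) v → w ≢ project w v
    centre≢ v wv eq = irref G (subst (Adj G w) (≡.sym eq) (project-edge v wv))
    leaves≢ : ∀ v v′ → v ≢ v′ → Adj G′ (base w) v → Adj G′ (base w) v′ → project w v ≢ project w v′
    leaves≢ v v′ v≢v′ wv wv′ eq = v≢v′ (project-injective v v′ wv wv′ eq)
  restrict-valid k3 (path w (base x) (base y) z) ((_ , w≢y , _ , x≢y , x≢z , _) , wx , xy , yz) =
    ((there (here refl) ,
      ((λ eq → irref G (subst (Adj G x) eq (project-edge w xw))) ,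
       (λ eq → w≢y (project-injective w (base y) xw xy eq)) ,
       (λ eq → k3 (x , y , project x w , proj₁ xy , subst (Adj G y) (≡.sym eq) (project-edge z yz) , project-edge w xw)) ,
       (λ { refl → x≢y refl }) ,
       (λ eq → x≢z (≡.sym (project-injective z (base x) yz (sym G′ {base x} {base y} xy) (≡.sym eq)))) ,
       (λ eq → irref G (subst (Adj G y) (≡.sym eq) (project-edge z yz)))) ,
      sym G (project-edge w xw) , proj₁ xy , project-edge z yz) , proj₂ xy) ∷ []
    where
    xw : Adj G′ (base x) w
    xw = sym G′ {w} {base x} wx
  restrict-valid _ (star (fish _ _) _ _ _) _ = []
  restrict-valid _ (tri _ _ _) _ = []
  restrict-valid _ (path _ (fish _ _) _ _) _ = []
  restrict-valid _ (path _ (base _) (fish _ _) _) _ = []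

  BaseCounts HubCounts : Piece W → Set
  BaseCounts p = ∀ y → ¬ InM y → count y (edges (restrict p)) ≡ count′ (mapEdge inj₁ y) (pieceEdges p)
  HubCounts p = ∀ i → count (edgeM i) (edges (restrict p)) + faOf i p ≡ hubsOf i p

  star-counts : ∀ w x y z → ValidPiece G′ (star (base w) x y z) →
                BaseCounts (star (base w) x y z) × HubCounts (star (base w) x y z)
  star-counts w x y z (_ , wx , wy , wz) =
    (λ _ y∉M → cong₂ _+_ (project-count x y∉M wx) (cong₂ _+_ (project-count y y∉M wy) (cong (_+ 0) (project-count z y∉M wz)))) ,
    (λ i → trans (+-interleave₃ (hitM i (w , project w x)) (hitM i (w , project w y)) (hitM i (w , project w z))
                                (hitFa i (base w , x)) (hitFa i (base w , y)) (hitFa i (base w , z)))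
                 (cong₂ _+_ (project-hub i x wx) (cong₂ _+_ (project-hub i y wy) (cong (_+ 0) (project-hub i z wz)))))

  path-counts : ∀ w x y z → ValidPiece G′ (path w (base x) (base y) z) →
                BaseCounts (path w (base x) (base y) z) × HubCounts (path w (base x) (base y) z)
  path-counts w x y z (_ , wx , xy , yz) =
    (λ _ y∉M → cong₂ _+_ (project-count˘ w y∉M xw) (cong₂ _+_ (project-count (base y) y∉M xy) (cong (_+ 0) (project-count z y∉M yz)))) ,
    (λ i → trans (+-interleave₃ (hitM i (project x w , x)) (hitM i (x , y)) (hitM i (y , project y z))
                                (hitFa i (w , base x)) (hitFa i (base x , base y)) (hitFa i (base y , z)))
                 (cong₂ _+_ (project-hub˘ i w xw) (cong₂ _+_ (project-hub i (base y) xy) (cong (_+ 0) (project-hub i z yz)))))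
    where
    xw : Adj G′ (base x) w
    xw = sym G′ {w} {base x} wx

  dropped-counts : ∀ {p} j → InCopy (rolePiece j p) → restrict p ≡ [] → ValidPiece G′ p →
                   (∀ i → Admissible (rolePiece i p)) → BaseCounts p × HubCounts p
  dropped-counts {p} j in-j restricted valid admissible =
    (λ (u , v) _ → trans (cong (λ qs → count (u , v) (edges qs)) restricted) (≡.sym (oldCount-role j p no-old u v))) ,
    (λ i → trans (cong (λ qs → count (edgeM i) (edges qs) + faOf i p) restricted) (fa≡hubs i))
    where
    confined : Confined (rolePiece j p)
    confined = in-copy⇒confined (rolePiece j p) (roles-valid j p valid) in-j (admissible j)

    no-alien : All (_≢ alien) (vertices (rolePiece j p))
    no-alien = proj₁ confined

    no-old : oldCount (rolePiece j p) ≡ 0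
    no-old = proj₁ (proj₂ confined)

    fa≡hubs : ∀ i → faOf i p ≡ hubsOf i p
    fa≡hubs i with i Fin.≟ j
    ... | yes refl = trans (≡.sym (faCount-role i p)) (trans (proj₂ (proj₂ confined)) (hubCount-role i p valid))
    ... | no i≢j = trans (≡.sym (faCount-role i p)) (trans (proj₁ none) (trans (≡.sym (proj₂ none)) (hubCount-role i p valid)))
      where
      own-free : All (λ x → ¬ IsOwn x) (vertices (rolePiece i p))
      own-free = subst (All _) (≡.sym (vertices-mapPiece (role i) p))
                   (All.map⁺ (All.map (λ {x} → alien-free⇒own-free (λ j≡i → i≢j (≡.sym j≡i)) x)
                                      (All.map⁻ (subst (All _) (vertices-mapPiece (role j) p) no-alien))))
      none : faCount (rolePiece i p) ≡ 0 × hubCount (rolePiece i p) ≡ 0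
      none = no-own⇒no-hub (rolePiece i p) own-free

  restrict-counts : K3Free G → ∀ p → ValidPiece G′ p → (∀ i → Admissible (rolePiece i p)) → BaseCounts p × HubCounts p
  restrict-counts k3 p valid admissible with restriction k3 p valid
  ... | kept-star w x y z = star-counts w x y z valid
  ... | kept-path w x y z = path-counts w x y z valid
  ... | dropped j in-j restricted = dropped-counts j in-j restricted valid admissible

  backward : K3Free G → ∀ {ps′} → Decomposition G′ S₃ ps′ →
             Σ (List (Piece (Fin n))) λ ps → Decomposition G S₂ ps × All (λ p → ¬ MiddleIn M p) ps
  backward k3 {ps′} D′@(valid′ , _) =
    concatMap restrict ps′ , count≡1⇒decomposition G S₂ (All.map proj₁ restricted-valid) once , All.map proj₂ restricted-valid
    where
    restricted-valid : All (λ q → ValidIn G S₂ q × ¬ MiddleIn M q) (concatMap restrict ps′)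
    restricted-valid = All.concat⁺ (All.map⁺ (All.map (λ {p} v → restrict-valid k3 p (proj₂ v)) valid′))

    E′ : List (W × W)
    E′ = edges ps′

    once′ : ∀ {z} → IsEdge G′ z → count′ z E′ ≡ 1
    once′ = decomposition⇒count≡1′ G′ S₃ D′

    fa-total : ∀ i → ∑ (faOf i) ps′ ≡ 1
    fa-total i = trans (≡.sym (count-edges′ (fish i f , fish i a) ps′)) (once′ (refl , tt))

    hub-total : ∀ i → ∑ (hubsOf i) ps′ ≡ 2
    hub-total i = begin
      ∑ (hubsOf i) ps′                          ≡⟨ ∑-concatMap (hubIndicator i) pieceEdges ps′ ⟨
      ∑ (hubIndicator i) E′                     ≡⟨ ∑-+ E′ ⟩
      count′ (hub₁ i) E′ + count′ (hub₂ i) E′   ≡⟨ cong₂ _+_ (once′ (inj₁ refl)) (once′ (inj₂ refl)) ⟩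
      2                                         ∎

    inner-total : ∀ i → ∑ (innerOf i) ps′ ≡ 8
    inner-total i = begin
      ∑ (innerOf i) ps′
        ≡⟨ ∑-comm (λ p pq → count′ (mapEdge (fishOf i) pq) (pieceEdges p)) ps′ cfEdges ⟩
      ∑ (λ pq → ∑ (λ p → count′ (mapEdge (fishOf i) pq) (pieceEdges p)) ps′) cfEdges
        ≡⟨ ∑-cong (λ pq → count-edges′ (mapEdge (fishOf i) pq) ps′) cfEdges ⟨
      ∑ (λ pq → count′ (mapEdge (fishOf i) pq) E′) cfEdges
        ≡⟨ ∑-cong-All (All.map (λ {pq} → once′ {mapEdge (fishOf i) pq}) fish-edges) ⟩
      8 ∎
      where
      fish-edges : All (λ pq → IsEdge G′ (mapEdge (fishOf i) pq)) cfEdges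
      fish-edges = (refl , tt) ∷ (refl , tt) ∷ (refl , tt) ∷ (refl , tt) ∷ (refl , tt) ∷ (refl , tt) ∷ (refl , tt) ∷ (refl , tt) ∷ []

    admissible : ∀ i → All (λ p → Admissible (rolePiece i p)) ps′
    admissible i = Budget.all-admissible (λ p → faCount (rolePiece i p)) (λ p → innerCount (rolePiece i p))
                                         (λ p → hubCount (rolePiece i p)) ps′
      (All.map (λ {p} v → classify (rolePiece i p) (roles-valid i p (proj₂ v))) valid′)
      (trans (∑-cong (faCount-role i) ps′) (fa-total i))
      (trans (∑-cong (innerCount-role i) ps′) (inner-total i))
      (trans (∑-cong-All (All.map (λ {p} v → hubCount-role i p (proj₂ v)) valid′)) (hub-total i))

    counts : All (λ p → BaseCounts p × HubCounts p) ps′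
    counts = All.tabulate λ {p} p∈ → restrict-counts k3 p (proj₂ (All.lookup valid′ p∈)) (λ i → All.lookup (admissible i) p∈)

    once : ∀ {y} → IsEdge G y → count y (edges (concatMap restrict ps′)) ≡ 1
    once {y} y-edge = trans (count-edges-concatMap y restrict ps′) (by-membership (inM? y))
      where
      by-membership : Dec (InM y) → ∑ (λ p → count y (edges (restrict p))) ps′ ≡ 1
      by-membership (no y∉M) = begin
        ∑ (λ p → count y (edges (restrict p))) ps′              ≡⟨ ∑-cong-All (All.map (λ cs → proj₁ cs y y∉M) counts) ⟩
        ∑ (λ p → count′ (mapEdge inj₁ y) (pieceEdges p)) ps′   ≡⟨ count-edges′ (mapEdge inj₁ y) ps′ ⟨
        count′ (mapEdge inj₁ y) E′                            ≡⟨ once′ (y-edge , y∉M) ⟩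
        1                                                     ∎
      by-membership (yes y∈M) = trans (∑-cong (λ p → count-resp (edges (restrict p)) y≈i) ps′) (ℕ.+-cancelʳ-≡ 1 _ _ (begin
        X + 1                                                        ≡⟨ cong (X +_) (fa-total i) ⟨
        X + ∑ (faOf i) ps′                                           ≡⟨ ∑-+ ps′ ⟨
        ∑ (λ p → count (edgeM i) (edges (restrict p)) + faOf i p) ps′ ≡⟨ ∑-cong-All (All.map (λ cs → proj₂ cs i) counts) ⟩
        ∑ (hubsOf i) ps′                                             ≡⟨ hub-total i ⟩
        2                                                            ∎))
        where
        i : Fin (length M)
        i = Any.index y∈M

        y≈i : SameEdge y (edgeM i)
        y≈i = lookup-index y∈M

        X : ℕ
        X = ∑ (λ p → count (edgeM i) (edges (restrict p))) ps′

lemma5 : ∀ {n} (G : Graph (Fin n)) (dec : Decidable (Adj G)) →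
         2 ≤ n → Connected G → Cubic G dec → K3Free G →
         (M : List (Fin n × Fin n)) →
         All (λ e → Adj G (proj₁ e) (proj₂ e)) M →
         AllPairs (λ e f → ¬ SameEdge e f) M →
         (Σ (List (Piece (Fin n))) λ ps →
            Decomposition G (K13 ∷ P4 ∷ []) ps × All (λ p → ¬ MiddleIn M p) ps)
         ⇔
         (Σ (List (Piece (V' G M))) λ ps →
            Decomposition (attachCoFish G M) (K13 ∷ K3 ∷ P4 ∷ []) ps)
lemma5 G _ _ _ _ triangle-free M M⊆E M-distinct =
  mk⇔ (λ (ps , D , no-middle) → concatMap lift ps , forward D no-middle)
      (λ (_ , D′) → backward triangle-free D′)
  where open Gadget G M M⊆E M-distinct
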